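{- Let $\lambda=\langle\lambda_1,\dots,\lambda_k\rangle$ (with $\lambda_k>0$) and $\mu\subseteq\lambda$ be partitions such that the inner (north-west) boundary of $\lambda/\mu$ contains the entire outer (south-east) boundary of $\mu$. If $\lambda/\mu$ is contained in a ribbon (i.e. contains no $2\times2$ square of boxes), then the number of standard Young tableaux of shape $\lambda/\mu$ whose reading words avoid the pattern $231$ equals the number of partitions (including the empty one) whose Young diagram is contained in that of $\langle\lambda_1-\lambda_k,\lambda_1-\lambda_{k-1},\dots,\lambda_1-\lambda_2\rangle$. Otherwise, the number of such tableaux is $0$.
   Context: Young diagrams are drawn in English notation. A standard Young tableau of skew shape $\lambda/\mu$ with $N$ boxes is a filling of the boxes with $1,\dots,N$, each once, increasing along rows and down columns. The reading word of a tableau is obtained by reading rows left to right, starting with the bottom row and proceeding upward. A word avoids $231$ if it has no subsequence $w_aw_bw_c$ ($a<b<c$) with $w_c<w_a<w_b$. -}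

module Defs where

open import Data.Nat using (ℕ; zero; suc; _≤_; _<_; _∸_)
open import Data.List using (List; []; _∷_; length; map; reverse; concat; drop; upTo)
open import Data.Maybe using (Maybe; just; nothing)
open import Data.Product using (Σ; _×_)
open import Data.List.Relation.Unary.All using (All)
open import Data.List.Relation.Unary.Linked using (Linked)
open import Data.List.Relation.Unary.Unique.Propositional using (Unique)
open import Data.List.Membership.Propositional using (_∈_)
open import Data.List.Relation.Binary.Permutation.Propositional using (_↭_)
open import Function.Bundles using (_⇔_)
open import Relation.Binary.PropositionalEquality using (_≡_)
open import Relation.Nullary using (¬_)

-- Conventions: rows and columns are indexed from 0 (row 0 is the top row,
-- column 0 the leftmost column; English notation).

lookupM : {A : Set} → List A → ℕ → Maybe A
lookupM []       _       = nothing
lookupM (x ∷ xs) zero    = just x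
lookupM (x ∷ xs) (suc i) = lookupM xs i

-- i-th part of a partition (0-indexed), 0 beyond its length.
_‼_ : List ℕ → ℕ → ℕ
[]       ‼ _     = 0
(x ∷ xs) ‼ zero  = x
(x ∷ xs) ‼ suc i = xs ‼ i

IsPartition : List ℕ → Set
IsPartition p = Linked (λ a b → b ≤ a) p × All (λ a → 0 < a) p

_⊆ᵖ_ : List ℕ → List ℕ → Set
μ ⊆ᵖ la = ∀ r → μ ‼ r ≤ la ‼ r

InSkew : List ℕ → List ℕ → ℕ → ℕ → Set
InSkew la μ r c = μ ‼ r ≤ c × c < la ‼ r

-- The inner (north-west) boundary of la/μ contains the entire outer
-- (south-east) boundary of μ: every unit edge of the south-east boundary
-- path of μ borders a box of la/μ on its south-east side.
--  * vertical edge at the right end of row r of μ (r < ℓ(μ)): box (r , μ_r) ∈ la/μ;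
--  * horizontal edge under box (r , c) of μ with μ_{r+1} ≤ c < μ_r:
--    box (r+1 , c) ∈ la/μ.
BoundaryCond : List ℕ → List ℕ → Set
BoundaryCond la μ =
  (∀ r → r < length μ → InSkew la μ r (μ ‼ r)) ×
  (∀ r c → μ ‼ suc r ≤ c → c < μ ‼ r → InSkew la μ (suc r) c)

No2x2 : List ℕ → List ℕ → Set
No2x2 la μ = ∀ r c →
  ¬ (InSkew la μ r c × InSkew la μ r (suc c) ×
     InSkew la μ (suc r) c × InSkew la μ (suc r) (suc c))

-- A filling of la/μ is a list of rows (one per row 0..k-1 of la, k = ℓ(la));
-- row r lists the entries of the boxes (r , μ_r), …, (r , la_r - 1) from left to right.
rowLengths : List ℕ → List ℕ → List ℕ
rowLengths la μ = map (λ r → la ‼ r ∸ μ ‼ r) (upTo (length la))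

At : List ℕ → List (List ℕ) → ℕ → ℕ → ℕ → Set
At μ T r c a = Σ (List ℕ) λ row →
  lookupM T r ≡ just row × μ ‼ r ≤ c × lookupM row (c ∸ μ ‼ r) ≡ just a

IsSYT : List ℕ → List ℕ → List (List ℕ) → Set
IsSYT la μ T =
  map length T ≡ rowLengths la μ ×
  concat T ↭ map suc (upTo (length (concat T))) ×
  (∀ r c a b → At μ T r c a → At μ T r (suc c) b → a < b) ×
  (∀ r c a b → At μ T r c a → At μ T (suc r) c b → a < b)

readingWord : List (List ℕ) → List ℕ
readingWord T = concat (reverse T)

Avoids231 : List ℕ → Set
Avoids231 w = ∀ i j l x y z → i < j → j < l →
  lookupM w i ≡ just x → lookupM w j ≡ just y → lookupM w l ≡ just z →
  ¬ (z < x × x < y)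

AvoidingSYT : List ℕ → List ℕ → List (List ℕ) → Set
AvoidingSYT la μ T = IsSYT la μ T × Avoids231 (readingWord T)

PartitionIn : List ℕ → List ℕ → Set
PartitionIn ν ρ = IsPartition ρ × (∀ r → ρ ‼ r ≤ ν ‼ r)

nu : List ℕ → List ℕ
nu la = map (λ x → la ‼ 0 ∸ x) (reverse (drop 1 la))

_HasSize_ : {A : Set} → (A → Set) → ℕ → Set
_HasSize_ {A} P n = Σ (List A) λ xs →
  Unique xs × length xs ≡ n × (∀ x → (x ∈ xs) ⇔ P x)

module Submission where

-- The reading word lists the rows from the bottom up, so we describe λ/μ by its profile:
-- the rows bottom-up, each with its length and its overhang c, the number of columns it
-- shares with the row above; λ/μ is a ribbon iff every overhang is at most 1.  The heart
-- of the proof is a pair of facts about a 231-avoiding permutation whose first block is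
-- an increasing row of length m0+1.  PeelBottomRow: the block must be 1, 2, …, m0, m0+1+p
-- where p is a split of the (relabelled) rest, i.e. its first p entries are 1, …, p.
-- InsertBottomRow: conversely every split p yields such a permutation, and the splits of
-- the result are described explicitly.  Choosing the split row by row (from the top) gives
-- a bijection between admissible sequences and 231-avoiding fillings of the profile
-- (encoding-facts, encoding-complete, encoding-injective); the suffix sums of admissible
-- sequences are exactly the partitions inside ν (partitions-enumerated).

open import Defs
open import Data.Nat using (ℕ; zero; suc; _+_; _∸_; _≤_; _<_; _≤?_; _<?_; _⊓_; z≤n; s≤s)
open import Data.Nat.Properties
open import Data.Nat.ListAction using (sum)
open import Data.Nat.Solver using (module +-*-Solver)
open +-*-Solver using (solve; _:+_; _:=_)
open import Data.List using (List; []; _∷_; _++_; length; map; reverse; concat; drop; take; upTo; filter; [_])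
open import Data.List.Properties using (length-++; length-map; map-++; ++-assoc; take++drop≡id; concat-map; map-cong-local; filter-all; filter-none; filter-++; length-take; map-injective; take-map; drop-map; length-reverse; ∷-injective; ∷-injectiveˡ; ∷-injectiveʳ; unfold-reverse; reverse-involutive; length-drop; take-all; reverse-injective; reverse-++; length-upTo; concat-++; ++-identityʳ)
open import Data.Maybe using (just; nothing)
open import Data.Maybe.Properties using (just-injective)
open import Data.Product using (Σ; _×_; _,_; proj₁; proj₂)
open import Data.Sum using (_⊎_; inj₁; inj₂)
open import Data.Empty using (⊥; ⊥-elim)
open import Data.Unit using (⊤; tt)
open import Data.List.Relation.Unary.All using (All; []; _∷_)
import Data.List.Relation.Unary.All.Properties as AllP
import Data.List.Relation.Unary.All as All
import Data.List.Relation.Unary.Linked as Linked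
import Data.List.Relation.Unary.AllPairs as AllPairs
open import Data.List.Relation.Unary.Any using (here; there)
open import Data.List.Relation.Unary.Linked using (Linked; []; [-]; _∷_)
open import Data.List.Relation.Unary.AllPairs using (AllPairs; []; _∷_)
open import Data.List.Relation.Unary.Unique.Propositional using (Unique)
import Data.List.Relation.Unary.Unique.Propositional.Properties as UP
open import Data.List.Membership.Propositional using (_∈_)
open import Data.List.Membership.Propositional.Properties using (∈-++⁻; ∈-++⁺ˡ; ∈-++⁺ʳ; ∈-map⁺; ∈-map⁻; ∈-concat⁻′; ∈-concat⁺′)
open import Data.List.Relation.Binary.Disjoint.Propositional using (Disjoint)
open import Data.List.Relation.Binary.Permutation.Propositional using (_↭_; ↭-refl; ↭-sym; ↭-trans; ↭-reflexive; ↭⇒↭ₛ)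
open import Data.List.Relation.Binary.Permutation.Propositional.Properties using (All-resp-↭; ∈-resp-↭; drop-∷; map⁺; ++⁺ˡ; shift; filter-↭; ↭-length) renaming (++-comm to ↭-++-comm)
open import Relation.Binary.Definitions using (tri<; tri≈; tri>)
open import Relation.Binary.PropositionalEquality using (_≡_; _≢_; refl; sym; trans; cong; cong₂; subst; subst₂; setoid; module ≡-Reasoning)
open import Relation.Nullary using (¬_; yes; no)
open import Function.Bundles using (_⇔_; mk⇔)
import Data.List.Relation.Binary.Permutation.Setoid.Properties (setoid ℕ) as PermS

lookupM-++ˡ : {A : Set} (xs ys : List A) (i : ℕ) → i < length xs → lookupM (xs ++ ys) i ≡ lookupM xs i
lookupM-++ˡ (x ∷ xs) ys zero p = refl
lookupM-++ˡ (x ∷ xs) ys (suc i) (s≤s p) = lookupM-++ˡ xs ys i p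

lookupM-++ʳ : {A : Set} (xs ys : List A) (i : ℕ) → lookupM (xs ++ ys) (length xs + i) ≡ lookupM ys i
lookupM-++ʳ [] ys i = refl
lookupM-++ʳ (x ∷ xs) ys i = lookupM-++ʳ xs ys i

lookupM-map⁻ : {A B : Set} (f : A → B) (xs : List A) (i : ℕ) (y : B) → lookupM (map f xs) i ≡ just y →
         Σ A λ x → lookupM xs i ≡ just x × f x ≡ y
lookupM-map⁻ f (x ∷ xs) zero y refl = x , refl , refl
lookupM-map⁻ f (x ∷ xs) (suc i) y e = lookupM-map⁻ f xs i y e

lookupM-map⁺ : {A B : Set} (f : A → B) (xs : List A) (i : ℕ) (x : A) → lookupM xs i ≡ just x → lookupM (map f xs) i ≡ just (f x)
lookupM-map⁺ f (x ∷ xs) zero .x refl = refl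
lookupM-map⁺ f (x ∷ xs) (suc i) y e = lookupM-map⁺ f xs i y e

lookupM⇒∈ : {A : Set} (xs : List A) (i : ℕ) (x : A) → lookupM xs i ≡ just x → x ∈ xs
lookupM⇒∈ (y ∷ xs) zero x refl = here refl
lookupM⇒∈ (y ∷ xs) (suc i) x e = there (lookupM⇒∈ xs i x e)

∈⇒lookupM : {A : Set} (xs : List A) (x : A) → x ∈ xs → Σ ℕ λ i → i < length xs × lookupM xs i ≡ just x
∈⇒lookupM (y ∷ xs) x (here refl) = 0 , s≤s z≤n , refl
∈⇒lookupM (y ∷ xs) x (there p) with ∈⇒lookupM xs x p
... | i , q , e = suc i , s≤s q , e

lookupM⇒<length : {A : Set} (xs : List A) (i : ℕ) (x : A) → lookupM xs i ≡ just x → i < length xs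
lookupM⇒<length (y ∷ xs) zero x e = s≤s z≤n
lookupM⇒<length (y ∷ xs) (suc i) x e = s≤s (lookupM⇒<length xs i x e)

lookupM-‼ : (xs : List ℕ) (i : ℕ) → i < length xs → lookupM xs i ≡ just (xs ‼ i)
lookupM-‼ (x ∷ xs) zero p = refl
lookupM-‼ (x ∷ xs) (suc i) (s≤s p) = lookupM-‼ xs i p

‼-of-lookupM : (xs : List ℕ) (i x : ℕ) → lookupM xs i ≡ just x → xs ‼ i ≡ x
‼-of-lookupM (y ∷ xs) zero x refl = refl
‼-of-lookupM (y ∷ xs) (suc i) x e = ‼-of-lookupM xs i x e

lookupM-defined : {A : Set} (xs : List A) (i : ℕ) → i < length xs → Σ A λ x → lookupM xs i ≡ just x
lookupM-defined (x ∷ xs) zero p = x , refl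
lookupM-defined (x ∷ xs) (suc i) (s≤s p) = lookupM-defined xs i p

lookupM-ext : {A : Set} (xs ys : List A) → (∀ i → lookupM xs i ≡ lookupM ys i) → xs ≡ ys
lookupM-ext [] [] h = refl
lookupM-ext [] (y ∷ ys) h with h 0
... | ()
lookupM-ext (x ∷ xs) [] h with h 0
... | ()
lookupM-ext (x ∷ xs) (y ∷ ys) h with h 0
... | refl = cong (x ∷_) (lookupM-ext xs ys (λ i → h (suc i)))

lookupM-All : {A : Set} {P : A → Set} (xs : List A) → All P xs → (i : ℕ) (x : A) → lookupM xs i ≡ just x → P x
lookupM-All (y ∷ xs) (p ∷ ps) zero x refl = p
lookupM-All (y ∷ xs) (p ∷ ps) (suc i) x e = lookupM-All xs ps i x e

All-from-lookupM : {A : Set} {P : A → Set} (xs : List A) → (∀ i x → lookupM xs i ≡ just x → P x) → All P xs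
All-from-lookupM [] h = []
All-from-lookupM (x ∷ xs) h = h 0 x refl ∷ All-from-lookupM xs (λ i → h (suc i))

lookupM-beyond : {A : Set} (xs : List A) (i : ℕ) → length xs ≤ i → lookupM xs i ≡ nothing
lookupM-beyond [] i _ = refl
lookupM-beyond (x ∷ xs) (suc i) (s≤s h) = lookupM-beyond xs i h

lookupM-snoc : {A : Set} (xs : List A) (v : A) → lookupM (xs ++ [ v ]) (length xs) ≡ just v
lookupM-snoc [] v = refl
lookupM-snoc (x ∷ xs) v = lookupM-snoc xs v

lookupM-take : {A : Set} (p : ℕ) (xs : List A) (i : ℕ) (y : A) → lookupM (take p xs) i ≡ just y → i < p × lookupM xs i ≡ just y
lookupM-take (suc p) (x ∷ xs) zero y e = s≤s z≤n , e
lookupM-take (suc p) (x ∷ xs) (suc i) y e with lookupM-take p xs i y e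
... | a , b = s≤s a , b

lookupM-drop : {A : Set} (p : ℕ) (xs : List A) (i : ℕ) (y : A) → lookupM (drop p xs) i ≡ just y → lookupM xs (p + i) ≡ just y
lookupM-drop zero xs i y e = e
lookupM-drop (suc p) (x ∷ xs) i y e = lookupM-drop p xs i y e

All-take-lookupM : {A : Set} {P : A → Set} (p : ℕ) (xs : List A) → (∀ i x → lookupM xs i ≡ just x → i < p → P x) → All P (take p xs)
All-take-lookupM p xs h = All-from-lookupM (take p xs) (λ i y e → let (a , b) = lookupM-take p xs i y e in h i y b a)

All-drop-lookupM : {A : Set} {P : A → Set} (p : ℕ) (xs : List A) → (∀ i x → lookupM xs i ≡ just x → p ≤ i → P x) → All P (drop p xs)
All-drop-lookupM p xs h = All-from-lookupM (drop p xs) (λ i y e → h (p + i) y (lookupM-drop p xs i y e) (m≤m+n p i))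

drop-∈⇒∈ : {A : Set} (j : ℕ) (xs : List A) (u : A) → u ∈ drop j xs → u ∈ xs
drop-∈⇒∈ zero xs u m = m
drop-∈⇒∈ (suc j) (x ∷ xs) u m = there (drop-∈⇒∈ j xs u m)

index-split : (n i : ℕ) → i < n ⊎ Σ ℕ (λ i' → i ≡ n + i')
index-split zero i = inj₂ (i , refl)
index-split (suc n) zero = inj₁ (s≤s z≤n)
index-split (suc n) (suc i) with index-split n i
... | inj₁ p = inj₁ (s≤s p)
... | inj₂ (i' , e) = inj₂ (i' , cong suc e)

‼-snoc : (xs : List ℕ) (v : ℕ) → (xs ++ [ v ]) ‼ length xs ≡ v
‼-snoc [] v = refl
‼-snoc (x ∷ xs) v = ‼-snoc xs v

‼-map : (f : ℕ → ℕ) (xs : List ℕ) (i : ℕ) → i < length xs → map f xs ‼ i ≡ f (xs ‼ i)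
‼-map f (x ∷ xs) zero _ = refl
‼-map f (x ∷ xs) (suc i) (s≤s q) = ‼-map f xs i q

‼-∈ : (L : List ℕ) → ∀ j → j < length L → L ‼ j ∈ L
‼-∈ L j q = lookupM⇒∈ L j _ (lookupM-‼ L j q)

‼-beyond-length : (xs : List ℕ) (r : ℕ) → length xs ≤ r → xs ‼ r ≡ 0
‼-beyond-length [] r _ = refl
‼-beyond-length (x ∷ xs) (suc r) (s≤s h) = ‼-beyond-length xs r h

‼-positive : (xs : List ℕ) → All (0 <_) xs → (r : ℕ) → r < length xs → 0 < xs ‼ r
‼-positive (x ∷ xs) (p ∷ _) zero _ = p
‼-positive (x ∷ xs) (_ ∷ ps) (suc r) (s≤s h) = ‼-positive xs ps r h

∸-suc : ∀ n i → i < n → n ∸ i ≡ suc (n ∸ suc i)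
∸-suc (suc n) zero _ = refl
∸-suc (suc n) (suc i) (s≤s h) = ∸-suc n i h

∸-∸-suc : ∀ k r → r < k → k ∸ suc (k ∸ suc r) ≡ r
∸-∸-suc k r h = trans (cong (k ∸_) (sym (∸-suc k r h))) (m∸[m∸n]≡n (<⇒≤ h))

∸≡1 : ∀ a b → a ∸ b ≡ 1 → a ≡ suc b
∸≡1 (suc a) zero e = e
∸≡1 (suc a) (suc b) e = cong suc (∸≡1 a b e)

<-∸-cancel : ∀ {c a L} → a ≤ c → c ∸ a < L ∸ a → c < L
<-∸-cancel {c} {a} {L} ac h with c <? L
... | yes q = q
... | no q = ⊥-elim (<⇒≱ h (∸-monoˡ-≤ a (≮⇒≥ q)))

lookupM-reverse : {A : Set} (xs : List A) (i : ℕ) → i < length xs → lookupM (reverse xs) i ≡ lookupM xs (length xs ∸ suc i)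
lookupM-reverse [] i ()
lookupM-reverse (x ∷ xs) i h rewrite unfold-reverse x xs with index-split (length (reverse xs)) i
... | inj₁ q = trans (lookupM-++ˡ (reverse xs) [ x ] i q) (trans (lookupM-reverse xs i q') (cong (lookupM (x ∷ xs)) (sym (∸-suc (length xs) i q'))))
  where
    q' = subst (i <_) (length-reverse xs) q
... | inj₂ (zero , refl) = trans (lookupM-++ʳ (reverse xs) [ x ] 0) (cong (lookupM (x ∷ xs)) (sym e))
  where
    e : length xs ∸ (length (reverse xs) + 0) ≡ 0
    e = trans (cong₂ _∸_ (sym (length-reverse xs)) (+-identityʳ (length (reverse xs)))) (n∸n≡0 (length (reverse xs)))
... | inj₂ (suc i' , refl) = ⊥-elim (<⇒≱ h (≤-trans (s≤s (≤-reflexive (sym (length-reverse xs)))) (≤-trans (s≤s (m≤m+n _ i')) (≤-reflexive (sym (+-suc _ i'))))))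

lookupM-reverse-rows : {A : Set} (T : List A) {k : ℕ} → length T ≡ k → ∀ i → i < k → lookupM (reverse T) i ≡ lookupM T (k ∸ suc i)
lookupM-reverse-rows T refl i h = lookupM-reverse T i h

split-last : (m0 : ℕ) (B : List ℕ) → length B ≡ suc m0 → B ≡ take m0 B ++ [ B ‼ m0 ]
split-last zero (x ∷ []) e = refl
split-last (suc m0) (x ∷ B) e = cong (x ∷_) (split-last m0 B (suc-injective e))

take-suc : (xs : List ℕ) (r : ℕ) → r < length xs → take (suc r) xs ≡ take r xs ++ [ xs ‼ r ]
take-suc (x ∷ xs) zero _ = refl
take-suc (x ∷ xs) (suc r) (s≤s h) = cong (x ∷_) (take-suc xs r h)

drop1-‼ : (xs : List ℕ) (r : ℕ) → drop 1 xs ‼ r ≡ xs ‼ suc r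
drop1-‼ [] r = refl
drop1-‼ (x ∷ xs) r = refl

‼-decreasing⇒sorted : (xs : List ℕ) → (∀ r → xs ‼ suc r ≤ xs ‼ r) → Linked (λ a b → b ≤ a) xs
‼-decreasing⇒sorted [] h = []
‼-decreasing⇒sorted (x ∷ []) h = [-]
‼-decreasing⇒sorted (x ∷ y ∷ xs) h = h 0 ∷ ‼-decreasing⇒sorted (y ∷ xs) (λ r → h (suc r))

sorted⇒‼-decreasing : (xs : List ℕ) → Linked (λ a b → b ≤ a) xs → ∀ r → xs ‼ suc r ≤ xs ‼ r
sorted⇒‼-decreasing [] l r = z≤n
sorted⇒‼-decreasing (x ∷ []) l zero = z≤n
sorted⇒‼-decreasing (x ∷ []) l (suc r) = z≤n
sorted⇒‼-decreasing (x ∷ y ∷ xs) (p ∷ l) zero = p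
sorted⇒‼-decreasing (x ∷ y ∷ xs) (p ∷ l) (suc r) = sorted⇒‼-decreasing (y ∷ xs) l r

tail : List ℕ → List ℕ
tail [] = []
tail (x ∷ xs) = xs

tail-‼ : (ρ : List ℕ) (r : ℕ) → tail ρ ‼ r ≡ ρ ‼ suc r
tail-‼ [] r = refl
tail-‼ (x ∷ ρ) r = refl

length-tail≤ : ∀ {K} (ρ : List ℕ) → length ρ ≤ suc K → length (tail ρ) ≤ K
length-tail≤ [] _ = z≤n
length-tail≤ (x ∷ ρ) (s≤s h) = h

tail-sorted : (ρ : List ℕ) → Linked (λ a b → b ≤ a) ρ → Linked (λ a b → b ≤ a) (tail ρ)
tail-sorted [] l = []
tail-sorted (x ∷ ρ) l = Linked.tail l

positive-‼-ext : (xs ys : List ℕ) → All (0 <_) xs → All (0 <_) ys → (∀ r → xs ‼ r ≡ ys ‼ r) → xs ≡ ys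
positive-‼-ext [] [] _ _ h = refl
positive-‼-ext [] (y ∷ ys) _ (p ∷ _) h = ⊥-elim (<-irrefl (h 0) p)
positive-‼-ext (x ∷ xs) [] (p ∷ _) _ h = ⊥-elim (<-irrefl (sym (h 0)) p)
positive-‼-ext (x ∷ xs) (y ∷ ys) (_ ∷ px) (_ ∷ py) h = cong₂ _∷_ (h 0) (positive-‼-ext xs ys px py (λ r → h (suc r)))

length-‼-ext : (xs ys : List ℕ) → length xs ≡ length ys → (∀ r → xs ‼ r ≡ ys ‼ r) → xs ≡ ys
length-‼-ext [] [] _ h = refl
length-‼-ext (x ∷ xs) (y ∷ ys) l h = cong₂ _∷_ (h 0) (length-‼-ext xs ys (suc-injective l) (λ r → h (suc r)))

Unique-resp-↭ : {xs ys : List ℕ} → xs ↭ ys → Unique xs → Unique ys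
Unique-resp-↭ p = PermS.Unique-resp-↭ (↭⇒↭ₛ p)

Unique-suffix : {A : Set} (I ys : List A) → Unique (I ++ ys) → Unique ys
Unique-suffix [] ys u = u
Unique-suffix (x ∷ I) ys (_ ∷ u) = Unique-suffix I ys u

Unique-map-injectiveOn : {A B : Set} → (xs : List A) → (g : A → B) → Unique xs →
  (∀ x y → x ∈ xs → y ∈ xs → g x ≡ g y → x ≡ y) → Unique (map g xs)
Unique-map-injectiveOn [] g u h = []
Unique-map-injectiveOn (x ∷ xs) g (a ∷ u) h = All-m xs a (λ y m → h x y (here refl) (there m)) ∷ Unique-map-injectiveOn xs g u (λ y z m1 m2 → h y z (there m1) (there m2))
  where
    All-m : (ys : List _) → All (x ≢_) ys → (∀ y → y ∈ ys → g x ≡ g y → x ≡ y) → All (g x ≢_) (map g ys)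
    All-m [] [] _ = []
    All-m (y ∷ ys) (ne ∷ nes) hh = (λ e → ne (hh y (here refl) e)) ∷ All-m ys nes (λ z m → hh z (there m))

enumeration-size : {A B : Set} {P : B → Set} (g : A → B) (xs : List A) → Unique xs →
  (∀ x y → x ∈ xs → y ∈ xs → g x ≡ g y → x ≡ y) → (∀ y → (y ∈ map g xs) ⇔ P y) → P HasSize length xs
enumeration-size g xs u inj mem = map g xs , Unique-map-injectiveOn xs g u inj , length-map g xs , mem

map-map-inverse : (f g : ℕ → ℕ) (R : List (List ℕ)) → All (λ x → f (g x) ≡ x) (concat R) → map (map f) (map (map g) R) ≡ R
map-map-inverse f g [] a = refl
map-map-inverse f g (B ∷ R) a = cong₂ _∷_ (mm B (AllP.++⁻ˡ B a)) (map-map-inverse f g R (AllP.++⁻ʳ B a))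
  where
    mm : (B : List ℕ) → All (λ x → f (g x) ≡ x) B → map f (map g B) ≡ B
    mm [] _ = refl
    mm (x ∷ B) (h ∷ hs) = cong₂ _∷_ h (mm B hs)

concat-reverse-↭ : (T : List (List ℕ)) → concat (reverse T) ↭ concat T
concat-reverse-↭ [] = ↭-refl
concat-reverse-↭ (B ∷ T) rewrite unfold-reverse B T =
  ↭-trans (↭-reflexive (trans (sym (concat-++ (reverse T) [ B ])) (cong (concat (reverse T) ++_) (++-identityʳ B))))
    (↭-trans (↭-++-comm (concat (reverse T)) B) (++⁺ˡ B (concat-reverse-↭ T)))

consecutive-split : (T : List (List ℕ)) (r : ℕ) (X Y : List ℕ) → lookupM T r ≡ just X → lookupM T (suc r) ≡ just Y →
  Σ (List (List ℕ)) λ pre → Σ (List (List ℕ)) λ post → T ≡ pre ++ X ∷ Y ∷ post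
consecutive-split (X ∷ Y ∷ T) zero .X .Y refl refl = [] , T , refl
consecutive-split (Z ∷ T) (suc r) X Y e1 e2 with consecutive-split T r X Y e1 e2
... | pre , post , e = Z ∷ pre , post , cong (Z ∷_) e

reading-consecutive : (T : List (List ℕ)) (r : ℕ) (X Y : List ℕ) → lookupM T r ≡ just X → lookupM T (suc r) ≡ just Y →
  Σ (List ℕ) λ pre → Σ (List ℕ) λ post → readingWord T ≡ pre ++ Y ++ X ++ post
reading-consecutive T r X Y e1 e2 with consecutive-split T r X Y e1 e2
... | pre , post , refl = concat (reverse post) , concat (reverse pre) , (begin
    concat (reverse (pre ++ X ∷ Y ∷ post))
  ≡⟨ cong concat (reverse-++ pre (X ∷ Y ∷ post)) ⟩
    concat (reverse (X ∷ Y ∷ post) ++ reverse pre)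
  ≡⟨ cong (λ z → concat (z ++ reverse pre)) (reverse-++ (X ∷ Y ∷ []) post) ⟩
    concat ((reverse post ++ Y ∷ X ∷ []) ++ reverse pre)
  ≡⟨ cong concat (++-assoc (reverse post) (Y ∷ X ∷ []) (reverse pre)) ⟩
    concat (reverse post ++ Y ∷ X ∷ reverse pre)
  ≡⟨ sym (concat-++ (reverse post) (Y ∷ X ∷ reverse pre)) ⟩
    concat (reverse post) ++ Y ++ X ++ concat (reverse pre)
  ∎)
  where open ≡-Reasoning

increasing⇒head< : {x : ℕ} {xs : List ℕ} → Linked _<_ (x ∷ xs) → All (x <_) xs
increasing⇒head< [-] = []
increasing⇒head< (p ∷ l) = p ∷ All.map (λ q → <-trans p q) (increasing⇒head< l)

increasing-lookupM : (xs : List ℕ) → Linked _<_ xs → (i j x y : ℕ) → i < j → lookupM xs i ≡ just x → lookupM xs j ≡ just y → x < y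
increasing-lookupM (z ∷ xs) l zero (suc j) x y p refl e2 = lookupM-All xs (increasing⇒head< l) j y e2
increasing-lookupM (z ∷ xs) l (suc i) (suc j) x y (s≤s p) e1 e2 = increasing-lookupM xs (Linked.tail l) i j x y p e1 e2

lookupM-increasing : (xs : List ℕ) → (∀ i x y → lookupM xs i ≡ just x → lookupM xs (suc i) ≡ just y → x < y) → Linked _<_ xs
lookupM-increasing [] h = []
lookupM-increasing (x ∷ []) h = [-]
lookupM-increasing (x ∷ y ∷ xs) h = h 0 x y refl refl ∷ lookupM-increasing (y ∷ xs) (λ i → h (suc i))

increasing⇒Unique : (xs : List ℕ) → Linked _<_ xs → Unique xs
increasing⇒Unique [] l = []
increasing⇒Unique (x ∷ xs) l = All.map (λ p e → <⇒≢ p e) (increasing⇒head< l)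
   ∷ increasing⇒Unique xs (Linked.tail l)

increasing-++ : (xs ys : List ℕ) → Linked _<_ xs → Linked _<_ ys → All (λ x → All (x <_) ys) xs → Linked _<_ (xs ++ ys)
increasing-++ [] ys l1 l2 a = l2
increasing-++ (x ∷ []) [] l1 l2 a = [-]
increasing-++ (x ∷ []) (y ∷ ys) l1 l2 ((p ∷ _) ∷ _) = p ∷ l2
increasing-++ (x ∷ x' ∷ xs) ys (p ∷ l1) l2 (_ ∷ a) = p ∷ increasing-++ (x' ∷ xs) ys l1 l2 a

increasing-map-add : (c : ℕ) (xs : List ℕ) → Linked _<_ xs → Linked _<_ (map (c +_) xs)
increasing-map-add c [] l = []
increasing-map-add c (x ∷ []) l = [-]
increasing-map-add c (x ∷ y ∷ xs) (p ∷ l) = +-monoʳ-< c p ∷ increasing-map-add c (y ∷ xs) l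

increasing-drop : (j : ℕ) (xs : List ℕ) → Linked _<_ xs → Linked _<_ (drop j xs)
increasing-drop zero xs l = l
increasing-drop (suc j) [] l = []
increasing-drop (suc j) (x ∷ xs) l = increasing-drop j xs (Linked.tail l)

increasing-‼≥ : (x : ℕ) (L : List ℕ) → Linked _<_ (x ∷ L) → ∀ j → j < suc (length L) → x + j ≤ (x ∷ L) ‼ j
increasing-‼≥ x L l zero _ = ≤-reflexive (+-identityʳ x)
increasing-‼≥ x (y ∷ L) (p ∷ l) (suc j) (s≤s q) = ≤-trans (≤-reflexive (+-suc x j)) (≤-trans (+-monoˡ-≤ j p) (increasing-‼≥ y L l j q))

increasing-‼≥index : (L : List ℕ) → Linked _<_ L → ∀ j → j < length L → j ≤ L ‼ j
increasing-‼≥index (x ∷ L) l j q = ≤-trans (m≤n+m j x) (increasing-‼≥ x L l j q)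

increasing-‼ : (L : List ℕ) → Linked _<_ L → ∀ i j → i < j → j < length L → L ‼ i < L ‼ j
increasing-‼ L l i j p q = increasing-lookupM L l i j _ _ p (lookupM-‼ L i (<-trans p q)) (lookupM-‼ L j q)

increasing-‼-injective : (L : List ℕ) → Linked _<_ L → ∀ i j → i < length L → j < length L → L ‼ i ≡ L ‼ j → i ≡ j
increasing-‼-injective L l i j pi pj e with <-cmp i j
... | tri< a _ _ = ⊥-elim (<-irrefl e (increasing-‼ L l i j a pj))
... | tri≈ _ b _ = b
... | tri> _ _ c = ⊥-elim (<-irrefl (sym e) (increasing-‼ L l j i c pi))

drop-∈⁺ : (L : List ℕ) → Linked _<_ L → ∀ j u → j < length L → u ∈ L → L ‼ j ≤ u → u ∈ drop j L
drop-∈⁺ L l zero u _ m _ = m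
drop-∈⁺ (x ∷ L) l (suc j) u (s≤s q) (here refl) h =
  ⊥-elim (<⇒≱ (increasing-‼ (x ∷ L) l 0 (suc j) (s≤s z≤n) (s≤s q)) h)
drop-∈⁺ (x ∷ L) l (suc j) u (s≤s q) (there m) h = drop-∈⁺ L (Linked.tail l) j u q m h

drop-∈⁻ : (L : List ℕ) → Linked _<_ L → ∀ j u → j < length L → u ∈ drop j L → L ‼ j ≤ u
drop-∈⁻ (x ∷ L) l zero u _ (here refl) = ≤-refl
drop-∈⁻ (x ∷ L) l zero u _ (there m) = <⇒≤ (lookupM-All L (increasing⇒head< l) _ u (proj₂ (proj₂ (∈⇒lookupM L u m))))
drop-∈⁻ (x ∷ L) l (suc j) u (s≤s q) m = drop-∈⁻ L (Linked.tail l) j u q m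

increasing-map : (f : ℕ → ℕ) → (∀ x y → x < y → f x < f y) → (xs : List ℕ) → Linked _<_ xs → Linked _<_ (map f xs)
increasing-map f m [] l = []
increasing-map f m (x ∷ []) l = [-]
increasing-map f m (x ∷ y ∷ xs) (p ∷ l) = m x y p ∷ increasing-map f m (y ∷ xs) l

increasing-unmap : (f : ℕ → ℕ) → (∀ x y → f x < f y → x < y) → (xs : List ℕ) → Linked _<_ (map f xs) → Linked _<_ xs
increasing-unmap f m [] l = []
increasing-unmap f m (x ∷ []) l = [-]
increasing-unmap f m (x ∷ y ∷ xs) (p ∷ l) = m x y p ∷ increasing-unmap f m (y ∷ xs) l

zero-is-head : (L : List ℕ) → Linked _<_ L → 0 ∈ L → L ‼ 0 ≡ 0
zero-is-head (x ∷ L) l (here e) = sym e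
zero-is-head (x ∷ L) l (there m) = ⊥-elim (<⇒≱ (lookupM-All L (increasing⇒head< l) _ 0 (proj₂ (proj₂ (∈⇒lookupM L 0 m)))) z≤n)

range : ℕ → ℕ → List ℕ
range a zero = []
range a (suc k) = a ∷ range (suc a) k

length-range : ∀ a k → length (range a k) ≡ k
length-range a zero = refl
length-range a (suc k) = cong suc (length-range (suc a) k)

range-++ : ∀ a k1 k2 → range a (k1 + k2) ≡ range a k1 ++ range (a + k1) k2
range-++ a zero k2 = cong (λ z → range z k2) (sym (+-identityʳ a))
range-++ a (suc k1) k2 = cong (a ∷_) (trans (range-++ (suc a) k1 k2) (cong (λ z → range (suc a) k1 ++ range z k2) (sym (+-suc a k1))))

applyUpTo-range : (f : ℕ → ℕ) (a k : ℕ) → (∀ i → f i ≡ a + i) → Data.List.applyUpTo f k ≡ range a k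
applyUpTo-range f a zero h = refl
applyUpTo-range f a (suc k) h = cong₂ _∷_ (trans (h 0) (+-identityʳ a))
  (applyUpTo-range _ (suc a) k (λ i → trans (h (suc i)) (+-suc a i)))

upTo-range : ∀ k → upTo k ≡ range 0 k
upTo-range k = applyUpTo-range _ 0 k (λ i → refl)

map-suc-range : ∀ a k → map suc (range a k) ≡ range (suc a) k
map-suc-range a zero = refl
map-suc-range a (suc k) = cong (suc a ∷_) (map-suc-range (suc a) k)

map-suc-upTo : ∀ k → map suc (upTo k) ≡ range 1 k
map-suc-upTo k = trans (cong (map suc) (upTo-range k)) (map-suc-range 0 k)

map-add-range : ∀ c a k → map (c +_) (range a k) ≡ range (c + a) k
map-add-range c a zero = refl
map-add-range c a (suc k) = cong (c + a ∷_) (trans (map-add-range c (suc a) k) (cong (λ z → range z k) (+-suc c a)))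

map-sub-range : ∀ c a k → map (λ x → x ∸ c) (range (c + a) k) ≡ range a k
map-sub-range c a zero = refl
map-sub-range c a (suc k) = cong₂ _∷_ (m+n∸m≡n c a) (trans (cong (λ z → map (λ x → x ∸ c) (range z k)) (sym (+-suc c a))) (map-sub-range c (suc a) k))

range-increasing : ∀ a k → Linked _<_ (range a k)
range-increasing a zero = []
range-increasing a (suc zero) = [-]
range-increasing a (suc (suc k)) = n<1+n a ∷ range-increasing (suc a) (suc k)

range-∈⁻ : ∀ a k x → x ∈ range a k → a ≤ x × x < a + k
range-∈⁻ a (suc k) x (here refl) = ≤-refl , m<m+n a (s≤s z≤n)
range-∈⁻ a (suc k) x (there p) with range-∈⁻ (suc a) k x p
... | q1 , q2 = <⇒≤ q1 , subst (x <_) (sym (+-suc a k)) q2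

range-∈⁺ : ∀ a k x → a ≤ x → x < a + k → x ∈ range a k
range-∈⁺ a zero x p q = ⊥-elim (<-irrefl refl (≤-trans q (subst (_≤ x) (sym (+-identityʳ a)) p)))
range-∈⁺ a (suc k) x p q with m≤n⇒m<n∨m≡n p
... | inj₂ refl = here refl
... | inj₁ a<x = there (range-∈⁺ (suc a) k x a<x (subst (x <_) (+-suc a k) q))

range-All : ∀ a k → All (λ x → a ≤ x × x < a + k) (range a k)
range-All a k = All.tabulate (λ {x} p → range-∈⁻ a k x p)

Unique-range : ∀ a k → Unique (range a k)
Unique-range a k = increasing⇒Unique _ (range-increasing a k)

lookupM-range : ∀ a k i x → lookupM (range a k) i ≡ just x → x ≡ a + i
lookupM-range a (suc k) zero x refl = sym (+-identityʳ a)
lookupM-range a (suc k) (suc i) x e = trans (lookupM-range (suc a) k i x e) (sym (+-suc a i))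

lookupM-range⁺ : ∀ a k i → i < k → lookupM (range a k) i ≡ just (a + i)
lookupM-range⁺ a (suc k) zero _ = cong just (sym (+-identityʳ a))
lookupM-range⁺ a (suc k) (suc i) (s≤s q) = trans (lookupM-range⁺ (suc a) k i q) (cong just (sym (+-suc a i)))

lookupM-upTo : ∀ k r → r < k → lookupM (upTo k) r ≡ just r
lookupM-upTo k r h = trans (cong (λ z → lookupM z r) (upTo-range k)) (lookupM-range⁺ 0 k r h)

filter-≤-range : ∀ p n → p ≤ n → filter (λ x → x ≤? p) (range 1 n) ≡ range 1 p
filter-≤-range p n pn = trans (cong (filter (λ x → x ≤? p)) (trans (cong (range 1) (sym (m+[n∸m]≡n pn))) (range-++ 1 p (n ∸ p))))
  (trans (filter-++ (λ x → x ≤? p) (range 1 p) _)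
    (trans (cong₂ _++_ (filter-all (λ x → x ≤? p) (All.map (λ h → ≤-pred (proj₂ h)) (range-All 1 p)))
                         (filter-none (λ x → x ≤? p) (All.map (λ h → <⇒≱ (proj₁ h)) (range-All (1 + p) (n ∸ p)))))
       (++-identityʳ (range 1 p))))

upTo-∈⁻ : ∀ K t → t ∈ upTo K → t < K
upTo-∈⁻ K t m = proj₂ (range-∈⁻ 0 K t (subst (t ∈_) (upTo-range K) m))

upTo-∈⁺ : ∀ K t → t < K → t ∈ upTo K
upTo-∈⁺ K t h = subst (t ∈_) (sym (upTo-range K)) (range-∈⁺ 0 K t z≤n h)

perm-reverse : (T : List (List ℕ)) → concat T ↭ map suc (upTo (length (concat T))) → concat (reverse T) ↭ range 1 (length (concat (reverse T)))
perm-reverse T p = ↭-trans (concat-reverse-↭ T) (↭-trans p (↭-reflexive (trans (map-suc-upTo _) (cong (range 1) (sym (↭-length (concat-reverse-↭ T)))))))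

perm-unreverse : (T : List (List ℕ)) → concat (reverse T) ↭ range 1 (length (concat (reverse T))) → concat T ↭ map suc (upTo (length (concat T)))
perm-unreverse T p = ↭-trans (↭-sym (concat-reverse-↭ T)) (↭-trans p (↭-reflexive (trans (cong (range 1) (↭-length (concat-reverse-↭ T))) (sym (map-suc-upTo _)))))

avoids-subsequence : (w w' : List ℕ) (g : ℕ → ℕ) → (∀ i j → i < j → g i < g j) →
         (∀ i x → lookupM w' i ≡ just x → lookupM w (g i) ≡ just x) → Avoids231 w → Avoids231 w'
avoids-subsequence w w' g mono h av i j l x y z p q e1 e2 e3 = av (g i) (g j) (g l) x y z (mono i j p) (mono j l q) (h i x e1) (h j y e2) (h l z e3)

avoids-suffix : (B V : List ℕ) → Avoids231 (B ++ V) → Avoids231 V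
avoids-suffix B V = avoids-subsequence (B ++ V) V (length B +_) (λ i j p → +-monoʳ-< (length B) p) (λ i x e → trans (lookupM-++ʳ B V i) e)

avoids-relabel : (f : ℕ → ℕ) → (∀ x y → x ≤ y → f x ≤ f y) → (w : List ℕ) → Avoids231 w → Avoids231 (map f w)
avoids-relabel f mono w av i j l x' y' z' p q e1 e2 e3 (z'<x' , x'<y') with lookupM-map⁻ f w i x' e1 | lookupM-map⁻ f w j y' e2 | lookupM-map⁻ f w l z' e3
... | x , e1' , refl | y , e2' , refl | z , e3' , refl =
  av i j l x y z p q e1' e2' e3' (reflect z'<x' , reflect x'<y')
  where
    reflect : ∀ {a b} → f a < f b → a < b
    reflect {a} {b} fab with a <? b
    ... | yes r = r
    ... | no r = ⊥-elim (<⇒≱ fab (mono b a (≮⇒≥ r)))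

increasing⇒avoids : (w : List ℕ) → Linked _<_ w → Avoids231 w
increasing⇒avoids w l i j k x y z p q e1 e2 e3 (z<x , _) = <-asym z<x (increasing-lookupM w l i k x z (<-trans p q) e1 e3)

prefix-below-rest : (I R : List ℕ) → Linked _<_ I → All (λ a → All (a <_) R) I → ∀ i x → lookupM I i ≡ just x →
         ∀ l z → i < l → lookupM (I ++ R) l ≡ just z → x < z
prefix-below-rest I R linI IR i x xI l z il e with index-split (length I) l
... | inj₁ l<I = increasing-lookupM I linI i l x z il xI (trans (sym (lookupM-++ˡ I _ l l<I)) e)
... | inj₂ (l' , refl) = lookupM-All R (lookupM-All I IR i x xI) l' z (trans (sym (lookupM-++ʳ I R l')) e)

avoids-insert : (I P Q : List ℕ) (v : ℕ) → Linked _<_ I → All (λ a → All (a <_) (v ∷ P ++ Q)) I →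
         All (_< v) P → All (v <_) Q → Avoids231 (P ++ Q) → Avoids231 (I ++ v ∷ P ++ Q)
avoids-insert I P Q v linI IR Pv Qv avPQ i j l x y z i<j j<l e1 e2 e3 (z<x , x<y)
  with index-split (length I) i
... | inj₁ i<I = <-asym z<x (prefix-below-rest I _ linI IR i x (trans (sym (lookupM-++ˡ I _ i i<I)) e1) l z (<-trans i<j j<l) e3)
... | inj₂ (i' , refl) with index-split (length I) j | index-split (length I) l
... | inj₁ j<I | _ = <-asym i<j (≤-trans j<I (m≤m+n _ _))
... | _ | inj₁ l<I = <-asym (<-trans i<j j<l) (≤-trans l<I (m≤m+n _ _))
... | inj₂ (j' , refl) | inj₂ (l' , refl) with i' | j' | l'
...   | zero | zero | _ = <-irrefl refl i<j
...   | zero | suc j₀ | zero = <-asym (+-cancelˡ-< (length I) _ _ j<l) (s≤s z≤n)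
...   | zero | suc j₀ | suc l₀ = lastcase
  where
    ex : v ≡ x
    ex = just-injective (trans (sym (lookupM-++ʳ I (v ∷ P ++ Q) 0)) e1)
    ey : lookupM (P ++ Q) j₀ ≡ just y
    ey = trans (sym (lookupM-++ʳ I (v ∷ P ++ Q) (suc j₀))) e2
    ez : lookupM (P ++ Q) l₀ ≡ just z
    ez = trans (sym (lookupM-++ʳ I (v ∷ P ++ Q) (suc l₀))) e3
    j<l' : j₀ < l₀
    j<l' with +-cancelˡ-< (length I) _ _ j<l
    ... | s≤s q = q
    lastcase : ⊥
    lastcase with index-split (length P) j₀
    ... | inj₁ jP = <-asym (subst (_< y) (sym ex) x<y) (lookupM-All P Pv j₀ y (trans (sym (lookupM-++ˡ P Q j₀ jP)) ey))
    ... | inj₂ (j₁ , refl) with index-split (length P) l₀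
    ...   | inj₁ lP = <⇒≱ (<-trans j<l' lP) (m≤m+n _ _)
    ...   | inj₂ (l₁ , refl) = <-asym (subst (z <_) (sym ex) z<x) (lookupM-All Q Qv l₁ z (trans (sym (lookupM-++ʳ P Q l₁)) ez))
...   | suc i₀ | zero | _ = <-asym (+-cancelˡ-< (length I) _ _ i<j) (s≤s z≤n)
...   | suc i₀ | suc j₀ | zero = <-asym (+-cancelˡ-< (length I) _ _ j<l) (s≤s z≤n)
...   | suc i₀ | suc j₀ | suc l₀ = avPQ i₀ j₀ l₀ x y z (≤-pred (+-cancelˡ-< (length I) _ _ i<j)) (≤-pred (+-cancelˡ-< (length I) _ _ j<l))
        (trans (sym (lookupM-++ʳ I (v ∷ P ++ Q) (suc i₀))) e1) (trans (sym (lookupM-++ʳ I (v ∷ P ++ Q) (suc j₀))) e2)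
        (trans (sym (lookupM-++ʳ I (v ∷ P ++ Q) (suc l₀))) e3) (z<x , x<y)

MinimaPrefix : List ℕ → List ℕ → Set
MinimaPrefix [] Z = ⊤
MinimaPrefix (x ∷ I) Z = All (x <_) (I ++ Z) × MinimaPrefix I Z

increasing⇒minimaPrefix : (I : List ℕ) → Linked _<_ I → MinimaPrefix I []
increasing⇒minimaPrefix [] l = tt
increasing⇒minimaPrefix (x ∷ I) l = subst (All (x <_)) (sym (++-identityʳ I)) (increasing⇒head< l) , increasing⇒minimaPrefix I (Linked.tail l)

-- In a 231-avoiding word of distinct entries starting with an ascent a < b, the first
-- entry a is the minimum: a later z < a would give the pattern a b z.
head-is-minimum : (a b : ℕ) (R : List ℕ) → a < b → Unique (a ∷ b ∷ R) → Avoids231 (a ∷ b ∷ R) → All (a <_) (b ∷ R)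
head-is-minimum a b R a<b ((_ ∷ ua) ∷ _) av = a<b ∷ All-from-lookupM R h
  where
    h : ∀ i z → lookupM R i ≡ just z → a < z
    h i z e with z <? a
    ... | yes z<a = ⊥-elim (av 0 1 (suc (suc i)) a b z (s≤s z≤n) (s≤s (s≤s z≤n)) refl refl e (z<a , a<b))
    ... | no z≮a with m≤n⇒m<n∨m≡n (≮⇒≥ z≮a)
    ...   | inj₁ p = p
    ...   | inj₂ e' = ⊥-elim (lookupM-All R ua i z e e')

increasing-prefix-minima : (I V : List ℕ) (v : ℕ) → Linked _<_ (I ++ [ v ]) → Unique (I ++ v ∷ V) → Avoids231 (I ++ v ∷ V) → MinimaPrefix I (v ∷ V)
increasing-prefix-minima [] V v l u av = tt
increasing-prefix-minima (a ∷ []) V v (a<v ∷ _) u av = head-is-minimum a v V a<v u av , tt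
increasing-prefix-minima (a ∷ b ∷ I) V v (a<b ∷ l) u av = head-is-minimum a b (I ++ v ∷ V) a<b u av ,
  increasing-prefix-minima (b ∷ I) V v l (AllPairs.tail u) (avoids-suffix [ a ] _ av)

minimaPrefix-range : (I Z : List ℕ) (a N : ℕ) → MinimaPrefix I Z → I ++ Z ↭ range a N →
              I ≡ range a (length I) × Z ↭ range (a + length I) (N ∸ length I)
minimaPrefix-range [] Z a N mp p = refl , subst (λ t → Z ↭ range t N) (sym (+-identityʳ a)) p
minimaPrefix-range (x ∷ I) Z a zero mp p with ↭-length p
... | ()
minimaPrefix-range (x ∷ I) Z a (suc N) (xmin , mp) p = res
  where
    a∈ : a ∈ (x ∷ I ++ Z)
    a∈ = ∈-resp-↭ (↭-sym p) (here refl)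
    ge : All (a ≤_) (x ∷ I ++ Z)
    ge = All-resp-↭ (↭-sym p) (All.map proj₁ (range-All a (suc N)))
    xa : x ≡ a
    xa with a∈
    ... | here e = sym e
    ... | there q = ⊥-elim (<⇒≱ (lookupM-All _ xmin (proj₁ (∈⇒lookupM _ a q)) a (proj₂ (proj₂ (∈⇒lookupM _ a q)))) (All.head ge))
    res : (x ∷ I) ≡ range a (suc (length I)) × Z ↭ range (a + suc (length I)) (N ∸ length I)
    res with minimaPrefix-range I Z (suc a) N mp (drop-∷ (subst (λ t → t ∷ I ++ Z ↭ range a (suc N)) xa p))
    ... | e1 , p2 = cong₂ _∷_ xa e1 , subst (λ t → Z ↭ range t (N ∸ length I)) (sym (+-suc a (length I))) p2

avoids-split-after : (v : ℕ) (V : List ℕ) → Avoids231 (v ∷ V) → All (_≢ v) V → Σ ℕ λ s → s ≤ length V × All (_< v) (take s V) × All (v <_) (drop s V)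
avoids-split-after v [] av ne = 0 , z≤n , [] , []
avoids-split-after v (y ∷ V) av (y≢v ∷ ne) with y <? v
... | yes y<v with avoids-split-after v V (avoids-subsequence (v ∷ y ∷ V) (v ∷ V) g gm gl av) ne
  where
    g : ℕ → ℕ
    g zero = zero
    g (suc i) = suc (suc i)
    gm : ∀ i j → i < j → g i < g j
    gm zero (suc j) p = s≤s z≤n
    gm (suc i) (suc j) (s≤s p) = s≤s (s≤s p)
    gl : ∀ i x → lookupM (v ∷ V) i ≡ just x → lookupM (v ∷ y ∷ V) (g i) ≡ just x
    gl zero x e = e
    gl (suc i) x e = e
...   | s , sl , h1 , h2 = suc s , s≤s sl , y<v ∷ h1 , h2
avoids-split-after v (y ∷ V) av (y≢v ∷ ne) | no y≮v = 0 , z≤n , [] , (v<y ∷ All-from-lookupM V h)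
  where
    v<y : v < y
    v<y with m≤n⇒m<n∨m≡n (≮⇒≥ y≮v)
    ... | inj₁ p = p
    ... | inj₂ e = ⊥-elim (y≢v (sym e))
    h : ∀ i z → lookupM V i ≡ just z → v < z
    h i z e with z <? v
    ... | yes z<v = ⊥-elim (av 0 1 (suc (suc i)) v y z (s≤s z≤n) (s≤s (s≤s z≤n)) refl refl e (z<v , v<y))
    ... | no z≮v with m≤n⇒m<n∨m≡n (≮⇒≥ z≮v)
    ...   | inj₁ p = p
    ...   | inj₂ e' = ⊥-elim (lookupM-All V ne i z e (sym e'))

-- q is a split of a word W when the first q entries of W are ≤ q and the others > q;
-- for a permutation of 1,…,n this says the first q entries are exactly 1,…,q.
IsSplit : ℕ → List ℕ → Set
IsSplit q W = q ≤ length W × (∀ i x → lookupM W i ≡ just x → i < q → x ≤ q) × (∀ i x → lookupM W i ≡ just x → q ≤ i → q < x)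

range-splits : ∀ q k → q ≤ k → IsSplit q (range 1 k)
range-splits q k qk = subst (q ≤_) (sym (length-range 1 k)) qk ,
  (λ i x e iq → subst (_≤ q) (sym (lookupM-range 1 k i x e)) iq) ,
  (λ i x e qi → subst (q <_) (sym (lookupM-range 1 k i x e)) (s≤s qi))

zero-split : (W : List ℕ) → W ↭ range 1 (length W) → IsSplit 0 W
zero-split W perm = z≤n , (λ i x e ()) , (λ i x e _ → lookupM-All W (All-resp-↭ (↭-sym perm) (All.map proj₁ (range-All 1 (length W)))) i x e)

split-from-take-drop : (q : ℕ) (W : List ℕ) → q ≤ length W → All (_≤ q) (take q W) → All (q <_) (drop q W) → IsSplit q W
split-from-take-drop q W ql a1 a2 = ql ,
  (λ i x e iq → lookupM-All (take q W) a1 i x (trans (lk-take⁺ q W i iq) e)) ,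
  (λ i x e qi → lookupM-All (drop q W) a2 (i ∸ q) x (trans (lk-drop⁺ q W (i ∸ q)) (trans (cong (lookupM W) (m+[n∸m]≡n qi)) e)))
  where
    lk-take⁺ : ∀ q (W : List ℕ) i → i < q → lookupM (take q W) i ≡ lookupM W i
    lk-take⁺ (suc q) [] i _ = refl
    lk-take⁺ (suc q) (x ∷ W) zero _ = refl
    lk-take⁺ (suc q) (x ∷ W) (suc i) (s≤s h) = lk-take⁺ q W i h
    lk-drop⁺ : ∀ q (W : List ℕ) i → lookupM (drop q W) i ≡ lookupM W (q + i)
    lk-drop⁺ zero W i = refl
    lk-drop⁺ (suc q) [] i = refl
    lk-drop⁺ (suc q) (x ∷ W) i = lk-drop⁺ q W i

-- lift m0 p makes room for the bottom row 1,…,m0 and its last entry m0+1+p: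
-- values ≤ p are shifted by m0, larger values by m0+1.  unlift undoes it.
lift : ℕ → ℕ → ℕ → ℕ
lift m0 p x with x ≤? p
... | yes _ = m0 + x
... | no _ = suc (m0 + x)

lift-≤ : ∀ m0 p x → x ≤ p → lift m0 p x ≡ m0 + x
lift-≤ m0 p x h with x ≤? p
... | yes _ = refl
... | no q = ⊥-elim (q h)

lift-> : ∀ m0 p x → p < x → lift m0 p x ≡ suc (m0 + x)
lift-> m0 p x h with x ≤? p
... | yes q = ⊥-elim (<⇒≱ h q)
... | no _ = refl

lift-≥ : ∀ m0 p x → m0 + x ≤ lift m0 p x
lift-≥ m0 p x with x ≤? p
... | yes _ = ≤-refl
... | no _ = n≤1+n _

lift-≤suc : ∀ m0 p x → lift m0 p x ≤ suc (m0 + x)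
lift-≤suc m0 p x with x ≤? p
... | yes _ = n≤1+n _
... | no _ = ≤-refl

lift-mono-< : ∀ m0 p x y → x < y → lift m0 p x < lift m0 p y
lift-mono-< m0 p x y h with x ≤? p | y ≤? p
... | yes _ | yes _ = +-monoʳ-< m0 h
... | yes _ | no _ = s≤s (+-monoʳ-≤ m0 (<⇒≤ h))
... | no a | yes b = ⊥-elim (a (≤-trans (<⇒≤ h) b))
... | no _ | no _ = s≤s (+-monoʳ-< m0 h)

lift-mono-≤ : ∀ m0 p x y → x ≤ y → lift m0 p x ≤ lift m0 p y
lift-mono-≤ m0 p x y h with m≤n⇒m<n∨m≡n h
... | inj₁ q = <⇒≤ (lift-mono-< m0 p x y q)
... | inj₂ refl = ≤-refl

lift-reflects-< : ∀ m0 p x y → lift m0 p x < lift m0 p y → x < y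
lift-reflects-< m0 p x y h with x <? y
... | yes q = q
... | no q = ⊥-elim (<⇒≱ h (lift-mono-≤ m0 p y x (≮⇒≥ q)))

lift-injective : ∀ m0 p x y → lift m0 p x ≡ lift m0 p y → x ≡ y
lift-injective m0 p x y e with <-cmp x y
... | tri< a _ _ = ⊥-elim (<-irrefl e (lift-mono-< m0 p x y a))
... | tri≈ _ b _ = b
... | tri> _ _ c = ⊥-elim (<-irrefl (sym e) (lift-mono-< m0 p y x c))

unlift : ℕ → ℕ → ℕ → ℕ
unlift m0 v x with x <? v
... | yes _ = x ∸ m0
... | no _ = x ∸ suc m0

unlift-< : ∀ m0 v x → x < v → unlift m0 v x ≡ x ∸ m0
unlift-< m0 v x h with x <? v
... | yes _ = refl
... | no q = ⊥-elim (q h)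

unlift-≥ : ∀ m0 v x → v ≤ x → unlift m0 v x ≡ x ∸ suc m0
unlift-≥ m0 v x h with x <? v
... | yes q = ⊥-elim (<⇒≱ q h)
... | no _ = refl

unlift-mono : ∀ m0 v x y → x ≤ y → unlift m0 v x ≤ unlift m0 v y
unlift-mono m0 v x y h with x <? v | y <? v
... | yes _ | yes _ = ∸-monoˡ-≤ m0 h
... | yes a | no b = ≤-trans (∸-monoˡ-≤ (suc m0) a) (∸-monoˡ-≤ (suc m0) (≮⇒≥ b))
... | no a | yes b = ⊥-elim (a (≤-<-trans h b))
... | no _ | no _ = ∸-monoˡ-≤ (suc m0) h

lookupM-bottomRow : ∀ m0 v i x → lookupM (range 1 m0 ++ [ v ]) i ≡ just x → (i < m0 × x ≡ suc i) ⊎ (i ≡ m0 × x ≡ v)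
lookupM-bottomRow m0 v i x e with index-split (length (range 1 m0)) i
... | inj₁ q = inj₁ (subst (i <_) (length-range 1 m0) q , lookupM-range 1 m0 i x (trans (sym (lookupM-++ˡ (range 1 m0) _ i q)) e))
... | inj₂ (zero , refl) = inj₂ (trans (+-identityʳ _) (length-range 1 m0) , sym (just-injective (trans (sym (lookupM-++ʳ (range 1 m0) [ v ] 0)) e)))
... | inj₂ (suc i' , refl) with trans (sym (lookupM-++ʳ (range 1 m0) [ v ] (suc i'))) e
... | ()

bottomRow-last : ∀ m0 v → (range 1 m0 ++ [ v ]) ‼ m0 ≡ v
bottomRow-last m0 v = trans (cong ((range 1 m0 ++ [ v ]) ‼_) (sym (length-range 1 m0))) (‼-snoc (range 1 m0) v)

length-bottomRow : ∀ m0 v → length (range 1 m0 ++ [ v ]) ≡ suc m0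
length-bottomRow m0 v = trans (length-++ (range 1 m0)) (trans (cong (_+ 1) (length-range 1 m0)) (+-comm m0 1))

range-snoc-increasing : ∀ a k v → a + k ≤ v → Linked _<_ (range a k ++ [ v ])
range-snoc-increasing a zero v h = [-]
range-snoc-increasing a (suc zero) v h = subst (_≤ v) (+-comm a 1) h ∷ [-]
range-snoc-increasing a (suc (suc k)) v h = n<1+n a ∷ range-snoc-increasing (suc a) (suc k) v (subst (_≤ v) (+-suc a (suc k)) h)

-- The bottom row followed by the lifted word 1,…,n (with p ≤ n) is a permutation of
-- 1,…,m0+1+n: lifting leaves exactly the gap at v = m0+1+p.
bottomRow-perm : ∀ m0 p n → p ≤ n →
  (range 1 m0 ++ [ suc m0 + p ]) ++ map (lift m0 p) (range 1 n) ↭ range 1 (suc m0 + n)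
bottomRow-perm m0 p n p≤n = ↭-trans insert-v (↭-reflexive (sym tgt))
  where
    d = n ∸ p
    v = suc m0 + p
    X = range (suc m0) p
    Y = range (suc v) d
    n≡ : n ≡ p + d
    n≡ = sym (m+[n∸m]≡n p≤n)
    mapX : map (lift m0 p) (range 1 p) ≡ X
    mapX = trans (map-cong-local (All.map (λ {x} h → lift-≤ m0 p x (≤-pred (proj₂ h))) (range-All 1 p)))
           (trans (map-add-range m0 1 p) (cong (λ z → range z p) (+-comm m0 1)))
    mapY : map (lift m0 p) (range (1 + p) d) ≡ Y
    mapY = trans (map-cong-local (All.map (λ {x} h → lift-> m0 p x (proj₁ h)) (range-All (1 + p) d)))
           (trans (map-add-range (suc m0) (suc p) d) (cong (λ z → range z d) (+-suc (suc m0) p)))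
    src : (range 1 m0 ++ [ v ]) ++ map (lift m0 p) (range 1 n) ≡ range 1 m0 ++ (v ∷ (X ++ Y))
    src = trans (++-assoc (range 1 m0) [ v ] _)
          (cong (λ z → range 1 m0 ++ (v ∷ z))
            (trans (cong (λ z → map (lift m0 p) (range 1 z)) n≡)
            (trans (cong (map (lift m0 p)) (range-++ 1 p d))
            (trans (map-++ (lift m0 p) (range 1 p) (range (1 + p) d)) (cong₂ _++_ mapX mapY)))))
    tgt : range 1 (suc m0 + n) ≡ range 1 m0 ++ (X ++ (v ∷ Y))
    tgt = trans (cong (range 1) e1)
          (trans (range-++ 1 m0 (p + suc d))
          (cong (range 1 m0 ++_) (range-++ (1 + m0) p (suc d))))
      where
        e1 : suc m0 + n ≡ m0 + (p + suc d)
        e1 = trans (cong (suc m0 +_) n≡) (trans (sym (+-suc m0 (p + d))) (cong (m0 +_) (sym (+-suc p d))))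
    -- Moving v past the values below it yields the sorted list.
    insert-v : (range 1 m0 ++ [ v ]) ++ map (lift m0 p) (range 1 n) ↭ range 1 m0 ++ (X ++ (v ∷ Y))
    insert-v = ↭-trans (↭-reflexive src) (++⁺ˡ (range 1 m0) (↭-sym (shift v X Y)))

module InsertBottomRow (m0 p : ℕ) (W' : List ℕ) (perm' : W' ↭ range 1 (length W')) (pS : IsSplit p W') where
  v = suc m0 + p
  B = range 1 m0 ++ [ v ]
  W = B ++ map (lift m0 p) W'

  positive : All (1 ≤_) W'
  positive = All-resp-↭ (↭-sym perm') (All.map proj₁ (range-All 1 (length W')))

  lenW : length W ≡ suc m0 + length W'
  lenW = trans (length-++ B) (cong₂ _+_ (length-bottomRow m0 v) (length-map (lift m0 p) W'))

  lkW : ∀ i x → lookupM W i ≡ just x →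
        ((i < m0 × x ≡ suc i) ⊎ (i ≡ m0 × x ≡ v)) ⊎ Σ ℕ λ i' → Σ ℕ λ y → i ≡ suc m0 + i' × lookupM W' i' ≡ just y × x ≡ lift m0 p y
  lkW i x e with index-split (length B) i
  ... | inj₁ q = inj₁ (lookupM-bottomRow m0 v i x (trans (sym (lookupM-++ˡ B _ i q)) e))
  ... | inj₂ (i' , refl) with lookupM-map⁻ (lift m0 p) W' i' x (trans (sym (lookupM-++ʳ B _ i')) e)
  ...   | y , e' , refl = inj₂ (i' , y , cong (_+ i') (length-bottomRow m0 v) , e' , refl)

  lkW' : ∀ i' y → lookupM W' i' ≡ just y → lookupM W (suc m0 + i') ≡ just (lift m0 p y)
  lkW' i' y e = trans (cong (λ z → lookupM W (z + i')) (sym (length-bottomRow m0 v)))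
                (trans (lookupM-++ʳ B _ i') (lookupM-map⁺ (lift m0 p) W' i' y e))

  inserted-perm : W ↭ range 1 (length W)
  inserted-perm = ↭-trans (++⁺ˡ B (map⁺ (lift m0 p) perm'))
    (subst (λ k → B ++ map (lift m0 p) (range 1 (length W')) ↭ range 1 k) (sym lenW) (bottomRow-perm m0 p (length W') (proj₁ pS)))

  -- Since p is a split, lifting W' puts its first p entries below v and the rest above v,
  -- so the insertion lemma applies.
  inserted-avoids : Avoids231 W' → Avoids231 W
  inserted-avoids av' = subst Avoids231 (sym (trans (++-assoc (range 1 m0) [ v ] _) (cong (λ z → range 1 m0 ++ v ∷ z) PQ)))
    (avoids-insert (range 1 m0) P Q v (range-increasing 1 m0) IR Pv Qv (subst Avoids231 PQ (avoids-relabel (lift m0 p) (lift-mono-≤ m0 p) W' av')))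
    where
      P = map (lift m0 p) (take p W')
      Q = map (lift m0 p) (drop p W')
      PQ : map (lift m0 p) W' ≡ P ++ Q
      PQ = trans (cong (map (lift m0 p)) (sym (take++drop≡id p W'))) (map-++ (lift m0 p) (take p W') (drop p W'))
      big : All (m0 <_) (map (lift m0 p) W')
      big = AllP.map⁺ (All.map (λ {y} y≥1 → <-≤-trans (subst (m0 <_) (+-comm 1 m0) (n<1+n m0)) (≤-trans (+-monoʳ-≤ m0 y≥1) (lift-≥ m0 p y))) positive)
      IR : All (λ a → All (a <_) (v ∷ P ++ Q)) (range 1 m0)
      IR = All.map (λ {a} h → let a≤m0 = ≤-pred (proj₂ h) in
             ≤-<-trans a≤m0 (s≤s (m≤m+n m0 p)) ∷ All.map (λ {z} m0<z → ≤-<-trans a≤m0 m0<z) (subst (All (m0 <_)) PQ big))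
             (range-All 1 m0)
      Pv : All (_< v) P
      Pv = AllP.map⁺ (All-take-lookupM p W' (λ i y e ip → let y≤p = proj₁ (proj₂ pS) i y e ip in
             subst (_< v) (sym (lift-≤ m0 p y y≤p)) (s≤s (+-monoʳ-≤ m0 y≤p))))
      Qv : All (v <_) Q
      Qv = AllP.map⁺ (All-drop-lookupM p W' (λ i y e pi → let p<y = proj₂ (proj₂ pS) i y e pi in
             subst (v <_) (sym (lift-> m0 p y p<y)) (s≤s (+-monoʳ-< m0 p<y))))

  -- When p ≥ 1, the first entry of W' stays below v (this gives the column condition).
  first-below-v : 1 ≤ p → ∀ b → lookupM W' 0 ≡ just b → lift m0 p b < v
  first-below-v p≥1 b b0 = subst (_< v) (sym (lift-≤ m0 p b b≤p)) (s≤s (+-monoʳ-≤ m0 b≤p))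
    where
      b≤p : b ≤ p
      b≤p = proj₁ (proj₂ pS) 0 b b0 p≥1

  split-small : ∀ q → q ≤ m0 → IsSplit q W
  split-small q q≤m0 = subst (q ≤_) (sym lenW) (≤-trans q≤m0 (≤-trans (n≤1+n m0) (m≤m+n _ _))) , h1 , h2
    where
      h1 : ∀ i x → lookupM W i ≡ just x → i < q → x ≤ q
      h1 i x e iq with lkW i x e
      ... | inj₁ (inj₁ (_ , refl)) = iq
      ... | inj₁ (inj₂ (refl , _)) = ⊥-elim (<⇒≱ iq q≤m0)
      ... | inj₂ (i' , y , refl , _) = ⊥-elim (<⇒≱ iq (≤-trans q≤m0 (≤-trans (n≤1+n m0) (m≤m+n _ _))))
      h2 : ∀ i x → lookupM W i ≡ just x → q ≤ i → q < x
      h2 i x e qi with lkW i x e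
      ... | inj₁ (inj₁ (_ , refl)) = s≤s qi
      ... | inj₁ (inj₂ (_ , refl)) = s≤s (≤-trans q≤m0 (m≤m+n m0 p))
      ... | inj₂ (i' , y , _ , e' , refl) = <-≤-trans (s≤s (≤-trans q≤m0 (m≤m+n m0 (y ∸ 1)))) (≤-trans (≤-reflexive (trans (sym (+-suc m0 (y ∸ 1))) (cong (m0 +_) (m+[n∸m]≡n (lookupM-All W' positive i' y e'))))) (lift-≥ m0 p y))

  split-big : ∀ u → p ≤ u → IsSplit u W' → IsSplit (suc m0 + u) W
  split-big u p≤u (ulen , s1 , s2) = subst (suc m0 + u ≤_) (sym lenW) (+-monoʳ-≤ (suc m0) ulen) , h1 , h2
    where
      h1 : ∀ i x → lookupM W i ≡ just x → i < suc m0 + u → x ≤ suc m0 + u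
      h1 i x e iq with lkW i x e
      ... | inj₁ (inj₁ (i<m0 , refl)) = ≤-trans i<m0 (≤-trans (n≤1+n m0) (m≤m+n _ _))
      ... | inj₁ (inj₂ (_ , refl)) = +-monoʳ-≤ (suc m0) p≤u
      ... | inj₂ (i' , y , refl , e' , refl) = ≤-trans (lift-≤suc m0 p y) (s≤s (+-monoʳ-≤ m0 (s1 i' y e' (+-cancelˡ-< (suc m0) _ _ iq))))
      h2 : ∀ i x → lookupM W i ≡ just x → suc m0 + u ≤ i → suc m0 + u < x
      h2 i x e qi with lkW i x e
      ... | inj₁ (inj₁ (i<m0 , _)) = ⊥-elim (<⇒≱ (<-trans i<m0 (n<1+n m0)) (≤-trans (m≤m+n (suc m0) u) qi))
      ... | inj₁ (inj₂ (refl , _)) = ⊥-elim (<⇒≱ (n<1+n m0) (≤-trans (m≤m+n (suc m0) u) qi))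
      ... | inj₂ (i' , y , refl , e' , refl) =
        let u<y = s2 i' y e' (+-cancelˡ-≤ (suc m0) _ _ qi) in
        subst (suc m0 + u <_) (sym (lift-> m0 p y (≤-<-trans p≤u u<y))) (s≤s (+-monoʳ-< m0 u<y))

  split-inv : ∀ q → IsSplit q W → q ≤ m0 ⊎ Σ ℕ λ u → q ≡ suc m0 + u × p ≤ u × IsSplit u W'
  split-inv q (qlen , s1 , s2) with q ≤? m0
  ... | yes h = inj₁ h
  ... | no h = inj₂ (u , qe , p≤u , ulen , h1 , h2)
    where
      u = q ∸ suc m0
      qe : q ≡ suc m0 + u
      qe = sym (m+[n∸m]≡n (≰⇒> h))
      vq : v ≤ q
      vq = s1 m0 v (trans (lookupM-++ˡ B _ m0 (subst (m0 <_) (sym (length-bottomRow m0 v)) (n<1+n m0)))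
                      (trans (cong (lookupM (range 1 m0 ++ [ v ])) (sym (length-range 1 m0))) (lookupM-snoc (range 1 m0) v)))
                   (≰⇒> h)
      p≤u : p ≤ u
      p≤u = +-cancelˡ-≤ (suc m0) _ _ (subst (v ≤_) qe vq)
      ulen : u ≤ length W'
      ulen = +-cancelˡ-≤ (suc m0) _ _ (subst₂ _≤_ qe lenW qlen)
      h1 : ∀ i x → lookupM W' i ≡ just x → i < u → x ≤ u
      h1 i y e iu with y ≤? p
      ... | yes y≤p = ≤-trans y≤p p≤u
      ... | no y≰p = +-cancelˡ-≤ (suc m0) _ _ (subst₂ _≤_ (lift-> m0 p y (≰⇒> y≰p)) qe
                       (s1 (suc m0 + i) (lift m0 p y) (lkW' i y e) (subst (suc m0 + i <_) (sym qe) (+-monoʳ-< (suc m0) iu))))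
      h2 : ∀ i x → lookupM W' i ≡ just x → u ≤ i → u < x
      h2 i y e ui = +-cancelˡ-< (suc m0) _ _ (≤-trans (subst (_< lift m0 p y) qe (s2 (suc m0 + i) (lift m0 p y) (lkW' i y e) (subst (_≤ suc m0 + i) (sym qe) (+-monoʳ-≤ (suc m0) ui)))) (lift-≤suc m0 p y))

  module _ (L' : List ℕ) (linL : Linked _<_ L') (j : ℕ) (j<L : j < length L') (pj : p ≡ L' ‼ j) where
    L = range 0 (suc m0) ++ map (suc m0 +_) (drop j L')

    inserted-splits-increasing : Linked _<_ L
    inserted-splits-increasing = increasing-++ (range 0 (suc m0)) (map (suc m0 +_) (drop j L')) (range-increasing 0 (suc m0))
      (increasing-map-add (suc m0) (drop j L') (increasing-drop j L' linL))
      (All.map (λ {a} h → AllP.map⁺ (All.tabulate (λ {u} _ → ≤-trans (proj₂ h) (m≤m+n (suc m0) u)))) (range-All 0 (suc m0)))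

    inserted-splits⇒ : (∀ u → u ∈ L' → IsSplit u W') → ∀ q → q ∈ L → IsSplit q W
    inserted-splits⇒ chr q m with ∈-++⁻ (range 0 (suc m0)) m
    ... | inj₁ m1 = split-small q (≤-pred (proj₂ (range-∈⁻ 0 (suc m0) q m1)))
    ... | inj₂ m2 with ∈-map⁻ (suc m0 +_) m2
    ...   | u , uLd , refl = split-big u (subst (_≤ u) (sym pj) (drop-∈⁻ L' linL j u j<L uLd)) (chr u (drop-∈⇒∈ j L' u uLd))

    inserted-splits⇐ : (∀ u → IsSplit u W' → u ∈ L') → ∀ q → IsSplit q W → q ∈ L
    inserted-splits⇐ chr q s with split-inv q s
    ... | inj₁ q≤m0 = ∈-++⁺ˡ (range-∈⁺ 0 (suc m0) q z≤n (s≤s q≤m0))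
    ... | inj₂ (u , refl , p≤u , su) = ∈-++⁺ʳ (range 0 (suc m0)) (∈-map⁺ (suc m0 +_) (drop-∈⁺ L' linL j u j<L (chr u su) (subst (_≤ u) pj p≤u)))

module PeelBottomRow (m0 : ℕ) (B V : List ℕ) (lB : length B ≡ suc m0) (linB : Linked _<_ B)
                     (perm : B ++ V ↭ range 1 (length (B ++ V))) (av : Avoids231 (B ++ V)) where
  n = length V
  I = take m0 B
  v = B ‼ m0
  Bsn : B ≡ I ++ [ v ]
  Bsn = split-last m0 B lB
  lI : length I ≡ m0
  lI = trans (length-take m0 B) (trans (cong (m0 ⊓_) lB) (m≤n⇒m⊓n≡m (n≤1+n m0)))
  Weq : B ++ V ≡ I ++ v ∷ V
  Weq = trans (cong (_++ V) Bsn) (++-assoc I [ v ] V)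
  N = length (B ++ V)
  N≡ : N ≡ suc m0 + n
  N≡ = trans (length-++ B) (cong (_+ n) lB)
  permW : I ++ v ∷ V ↭ range 1 N
  permW = subst (_↭ range 1 N) Weq perm
  avW : Avoids231 (I ++ v ∷ V)
  avW = subst Avoids231 Weq av
  uW : Unique (I ++ v ∷ V)
  uW = Unique-resp-↭ (↭-sym permW) (Unique-range 1 N)

  -- The increasing prefix consists of successive minima, hence is 1,…,m0.
  MR = minimaPrefix-range I (v ∷ V) 1 N (increasing-prefix-minima I V v (subst (Linked _<_) Bsn linB) uW avW) permW
  Ieq : I ≡ range 1 m0
  Ieq = trans (proj₁ MR) (cong (range 1) lI)
  permvV : v ∷ V ↭ range (suc m0) (suc n)
  permvV = subst₂ (λ a k → v ∷ V ↭ range a k) (cong suc lI) (trans (cong₂ _∸_ N≡ lI) (trans (cong (_∸ m0) (sym (+-suc m0 n))) (m+n∸m≡n m0 (suc n)))) (proj₂ MR)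
  vrange = range-∈⁻ (suc m0) (suc n) v (∈-resp-↭ permvV (here refl))
  p = v ∸ suc m0
  veq : v ≡ suc m0 + p
  veq = sym (m+[n∸m]≡n (proj₁ vrange))

  bottom-row : B ≡ range 1 m0 ++ [ suc m0 + p ]
  bottom-row = trans Bsn (cong₂ (λ a b → a ++ [ b ]) Ieq veq)

  p≤n : p ≤ n
  p≤n = ≤-pred (+-cancelˡ-< (suc m0) _ _ (subst (_< suc m0 + suc n) veq (proj₂ vrange)))
  d = n ∸ p
  vsub : suc v ∸ suc m0 ≡ suc p
  vsub = trans (cong (λ z → suc z ∸ suc m0) veq) (trans (cong (_∸ m0) (sym (+-suc m0 p))) (m+n∸m≡n m0 (suc p)))

  X = range (suc m0) p
  Y = range (suc v) d
  permV : V ↭ X ++ Y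
  permV = drop-∷ (↭-trans permvV (↭-trans (↭-reflexive rngeq) (shift v X Y)))
    where
      rngeq : range (suc m0) (suc n) ≡ X ++ v ∷ Y
      rngeq = trans (cong (range (suc m0)) (trans (cong suc (sym (m+[n∸m]≡n p≤n))) (sym (+-suc p d))))
              (trans (range-++ (suc m0) p (suc d)) (cong (λ z → X ++ range z (suc d)) (sym veq)))

  un = unlift m0 v

  lift-unlift : All (λ x → lift m0 p (un x) ≡ x) V
  lift-unlift = All.tabulate λ {x} m → inverse (XY∈ x (∈-resp-↭ permV m))
    where
      XY∈ : ∀ x → x ∈ X ++ Y → (suc m0 ≤ x × x < v) ⊎ suc v ≤ x
      XY∈ x m with ∈-++⁻ X m
      ... | inj₁ mx = let h = range-∈⁻ (suc m0) p x mx in inj₁ (proj₁ h , subst (x <_) (sym veq) (proj₂ h))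
      ... | inj₂ my = inj₂ (proj₁ (range-∈⁻ (suc v) d x my))
      inverse : ∀ {x} → (suc m0 ≤ x × x < v) ⊎ suc v ≤ x → lift m0 p (un x) ≡ x
      inverse {x} (inj₁ (lo , hi)) = trans (cong (lift m0 p) (unlift-< m0 v x hi))
        (trans (lift-≤ m0 p (x ∸ m0) (≤-pred (subst (x ∸ m0 <_) (m+n∸m≡n m0 (suc p)) (∸-monoˡ-< (subst (x <_) (trans veq (sym (+-suc m0 p))) hi) (≤-trans (n≤1+n m0) lo)))))
                 (m+[n∸m]≡n (≤-trans (n≤1+n m0) lo)))
      inverse {x} (inj₂ hi) = trans (cong (lift m0 p) (unlift-≥ m0 v x (≤-trans (n≤1+n v) hi)))
        (trans (lift-> m0 p (x ∸ suc m0) (subst (_≤ x ∸ suc m0) vsub (∸-monoˡ-≤ (suc m0) hi)))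
                 (m+[n∸m]≡n (≤-trans (m≤m+n (suc m0) p) (≤-trans (≤-reflexive (sym veq)) (≤-trans (n≤1+n v) hi)))))

  unlift-XY : map un (X ++ Y) ≡ range 1 n
  unlift-XY = trans (map-++ un X Y) (trans (cong₂ _++_ mX mY) (trans (sym (range-++ 1 p d)) (cong (range 1) (m+[n∸m]≡n p≤n))))
    where
      mX : map un X ≡ range 1 p
      mX = trans (map-cong-local (All.map (λ {x} h → unlift-< m0 v x (subst (x <_) (sym veq) (proj₂ h))) (range-All (suc m0) p)))
                   (trans (cong (map (λ x → x ∸ m0)) (cong (λ z → range z p) (+-comm 1 m0))) (map-sub-range m0 1 p))
      mY : map un Y ≡ range (suc p) d
      mY = trans (map-cong-local (All.map (λ {x} h → unlift-≥ m0 v x (≤-trans (n≤1+n v) (proj₁ h))) (range-All (suc v) d)))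
                   (trans (cong (λ z → map (λ x → x ∸ suc m0) (range (suc z) d)) veq) (trans (cong (λ z → map (λ x → x ∸ suc m0) (range z d)) (sym (+-suc (suc m0) p))) (map-sub-range (suc m0) (suc p) d)))

  unlifted-perm : map un V ↭ range 1 (length (map un V))
  unlifted-perm = subst (λ k → map un V ↭ range 1 k) (sym (length-map un V)) (↭-trans (map⁺ un permV) (↭-reflexive unlift-XY))

  avV : Avoids231 (v ∷ V)
  avV = avoids-suffix I (v ∷ V) avW

  unlifted-avoids : Avoids231 (map un V)
  unlifted-avoids = avoids-relabel un (unlift-mono m0 v) V (avoids-suffix [ v ] V avV)

  -- After v, the entries below v come first (avoidance); there are exactly p of them.
  split-after-v = avoids-split-after v V avV (All.map (λ ne e → ne (sym e)) (AllPairs.head (Unique-suffix I (v ∷ V) uW)))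
  s = proj₁ split-after-v
  below : All (_< v) (take s V)
  below = proj₁ (proj₂ (proj₂ split-after-v))
  above : All (v <_) (drop s V)
  above = proj₂ (proj₂ (proj₂ split-after-v))
  below' : All (_≤ p) (map un (take s V))
  below' = AllP.map⁺ (All.map (λ {x} x<v → subst (_≤ p) (sym (unlift-< m0 v x x<v)) (∸-monoˡ-≤ (suc m0) x<v)) below)
  above' : All (p <_) (map un (drop s V))
  above' = AllP.map⁺ (All.map (λ {x} v<x →
             subst (p <_) (sym (unlift-≥ m0 v x (<⇒≤ v<x))) (subst (_≤ x ∸ suc m0) vsub (∸-monoˡ-≤ (suc m0) v<x))) above)

  s≡p : s ≡ p
  s≡p = trans (sym (m≤n⇒m⊓n≡m (proj₁ (proj₂ split-after-v)))) (trans (sym (length-take s V))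
          (trans (sym (length-map un (take s V))) (trans (↭-length filt) (length-range 1 p))))
    where
      p? = λ x → x ≤? p
      filt : map un (take s V) ↭ range 1 p
      filt = subst₂ _↭_ e1 (filter-≤-range p n p≤n) (filter-↭ p? (↭-trans (map⁺ un permV) (↭-reflexive unlift-XY)))
        where
          e1 : filter p? (map un V) ≡ map un (take s V)
          e1 = trans (cong (filter p?) (trans (cong (map un) (sym (take++drop≡id s V))) (map-++ un (take s V) (drop s V))))
                 (trans (filter-++ p? (map un (take s V)) (map un (drop s V)))
                 (trans (cong₂ _++_ (filter-all p? below') (filter-none p? (All.map (λ h → <⇒≱ h) above'))) (++-identityʳ _)))

  p-split : IsSplit p (map un V)
  p-split = split-from-take-drop p (map un V) (subst (p ≤_) (sym (length-map un V)) p≤n)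
    (subst (All (_≤ p)) (trans (sym (take-map s V)) (cong (λ z → take z (map un V)) s≡p)) below')
    (subst (All (p <_)) (trans (sym (drop-map s V)) (cong (λ z → drop z (map un V)) s≡p)) above')

  first-below⇒p≢0 : ∀ b → lookupM V 0 ≡ just b → b < v → p ≢ 0
  first-below⇒p≢0 b e b<v p≡0 = <-asym b<v (lookupM-All (drop s V) above 0 b (subst (λ z → lookupM (drop z V) 0 ≡ just b) (sym (trans s≡p p≡0)) e))

-- A profile lists the rows of a skew shape from the bottom row upwards: the pair
-- (m0 , c) describes a row of m0+1 boxes whose first box lies below the last box of
-- the next row up exactly when c = 1 (for a ribbon c ≤ 1 always).
Profile : Set
Profile = List (ℕ × ℕ)

-- span is the number of columns met by the rows of a profile (the overlaps counted once).
span : Profile → ℕ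
span [] = 0
span ((m0 , c) ∷ []) = suc m0
span ((m0 , c) ∷ (r ∷ prof)) = (suc m0 ∸ c) + span (r ∷ prof)

span-pos : (r : ℕ × ℕ) (prof : Profile) → 1 ≤ span (r ∷ prof)
span-pos (m0 , c) [] = s≤s z≤n
span-pos (m0 , c) (r ∷ prof) = ≤-trans (span-pos r prof) (m≤n+m _ _)

RibbonProfile : Profile → Set
RibbonProfile prof = All (λ r → proj₂ r ≤ 1) prof

-- An admissible sequence cs chooses, row by row from the top down, which
-- split of the word built so far receives the new bottom row: encode builds the rows
-- (bottom row first) and splits lists the splits of the resulting word.
splits : Profile → List ℕ → List ℕ
splits [] _ = []
splits ((m0 , c) ∷ []) _ = range 0 (suc (suc m0))
splits ((m0 , c) ∷ (r ∷ prof)) [] = []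
splits ((m0 , c) ∷ (r ∷ prof)) (t ∷ cs) = range 0 (suc m0) ++ map (suc m0 +_) (drop (c + t) (splits (r ∷ prof) cs))

encode : Profile → List ℕ → List (List ℕ)
encode [] _ = []
encode ((m0 , c) ∷ []) _ = [ range 1 (suc m0) ]
encode ((m0 , c) ∷ (r ∷ prof)) [] = []
encode ((m0 , c) ∷ (r ∷ prof)) (t ∷ cs) =
  (range 1 m0 ++ [ suc m0 + (splits (r ∷ prof) cs ‼ (c + t)) ]) ∷ map (map (lift m0 (splits (r ∷ prof) cs ‼ (c + t)))) (encode (r ∷ prof) cs)

Admissible : Profile → List ℕ → Set
Admissible [] cs = ⊥
Admissible (_ ∷ []) cs = cs ≡ []
Admissible ((m0 , c) ∷ (r ∷ prof)) [] = ⊥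
Admissible ((m0 , c) ∷ (r ∷ prof)) (t ∷ cs) = Admissible (r ∷ prof) cs × t + sum cs ≤ span (r ∷ prof) ∸ c

-- The column condition between the row B and the row above it, when they overlap.
Attached : ℕ → ℕ → List ℕ → List (List ℕ) → Set
Attached c m0 B [] = ⊤
Attached c m0 B (B' ∷ R) = c ≡ 1 → B' ‼ 0 < B ‼ m0

RowShape : Profile → List (List ℕ) → Set
RowShape [] [] = ⊤
RowShape [] (_ ∷ _) = ⊥
RowShape (_ ∷ _) [] = ⊥
RowShape ((m0 , c) ∷ prof) (B ∷ R) = length B ≡ suc m0 × Linked _<_ B × Attached c m0 B R × RowShape prof R

GoodFilling : Profile → List (List ℕ) → Set
GoodFilling prof R = RowShape prof R × concat R ↭ range 1 (length (concat R)) × Avoids231 (concat R)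

attached-map : (f : ℕ → ℕ) → (∀ x y → x < y → f x < f y) → (c m0 : ℕ) (B : List ℕ) → length B ≡ suc m0 →
           (prof : Profile) (R : List (List ℕ)) → RowShape prof R → Attached c m0 B R → Attached c m0 (map f B) (map (map f) R)
attached-map f m c m0 B lB prof [] rs h = tt
attached-map f m c m0 B lB ((_ , _) ∷ prof) ((b ∷ B') ∷ R) rs h e =
  subst (f b <_) (sym (‼-map f B m0 (subst (m0 <_) (sym lB) (n<1+n m0)))) (m _ _ (h e))

attached-unmap : (f : ℕ → ℕ) → (∀ x y → f x < f y → x < y) → (c m0 : ℕ) (B : List ℕ) → length B ≡ suc m0 →
           (prof : Profile) (R : List (List ℕ)) → RowShape prof (map (map f) R) → Attached c m0 (map f B) (map (map f) R) → Attached c m0 B R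
attached-unmap f m c m0 B lB prof [] rs h = tt
attached-unmap f m c m0 B lB ((_ , _) ∷ prof) ((b ∷ B') ∷ R) rs h e =
  m _ _ (subst (f b <_) (‼-map f B m0 (subst (m0 <_) (sym lB) (n<1+n m0))) (h e))

rowShape-map : (f : ℕ → ℕ) → (∀ x y → x < y → f x < f y) → (prof : Profile) (R : List (List ℕ)) → RowShape prof R → RowShape prof (map (map f) R)
rowShape-map f m [] [] h = tt
rowShape-map f m ((m0 , c) ∷ prof) (B ∷ R) (lB , linB , cn , rs) =
  trans (length-map f B) lB , increasing-map f m B linB , attached-map f m c m0 B lB prof R rs cn , rowShape-map f m prof R rs

rowShape-unmap : (f : ℕ → ℕ) → (∀ x y → f x < f y → x < y) → (prof : Profile) (R : List (List ℕ)) → RowShape prof (map (map f) R) → RowShape prof R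
rowShape-unmap f m [] [] h = tt
rowShape-unmap f m ((m0 , c) ∷ prof) (B ∷ R) (lB , linB , cn , rs) =
  lB' , increasing-unmap f m B linB , attached-unmap f m c m0 B lB' prof R rs cn , rowShape-unmap f m prof R rs
  where lB' = trans (sym (length-map f B)) lB

attached-first-below : (r : ℕ × ℕ) (prof : Profile) (c m0 : ℕ) (B : List ℕ) (R : List (List ℕ)) → RowShape (r ∷ prof) R → Attached c m0 B R → c ≡ 1 →
           Σ ℕ λ b → lookupM (concat R) 0 ≡ just b × b < B ‼ m0
attached-first-below (_ , _) prof c m0 B ((b ∷ B') ∷ R) rows cn e = b , refl , cn e
attached-first-below (_ , _) prof c m0 B ([] ∷ R) (() , _) cn e
attached-first-below (_ , _) prof c m0 B [] () cn e

splits-length-step : ∀ M c t L S span → L + S ≡ suc span → c + t ≤ L → c ≤ M → M + (L ∸ (c + t)) + (t + S) ≡ suc ((M ∸ c) + span)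
splits-length-step M c t L S span e ctL cM = goal
  where
    d = L ∸ (c + t)
    e' = M ∸ c
    Leq : L ≡ (c + t) + d
    Leq = sym (m+[n∸m]≡n ctL)
    Meq : M ≡ c + e'
    Meq = sym (m+[n∸m]≡n cM)
    key : (c + e') + d + (t + S) ≡ e' + ((c + t) + d + S)
    key = solve 5 (λ c e d t s → ((c :+ e) :+ d) :+ (t :+ s) := e :+ (((c :+ t) :+ d) :+ s)) refl c e' d t S
    goal : M + d + (t + S) ≡ suc (e' + span)
    goal = trans (cong (λ z → z + d + (t + S)) Meq) (trans key (trans (cong (λ z → e' + (z + S)) (sym Leq)) (trans (cong (e' +_) e) (+-suc e' span))))

choice-within-splits : ∀ c t S span L → t + S ≤ span ∸ c → c ≤ span → L + S ≡ suc span → c + t < L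
choice-within-splits c t S span L h cH e = +-cancelʳ-< S (c + t) L (subst (c + t + S <_) (sym e) (s≤s k))
  where
    k : c + t + S ≤ span
    k = subst₂ _≤_ (sym (+-assoc c t S)) (m+[n∸m]≡n cH) (+-monoʳ-≤ c h)

choice-bounded : ∀ c t S span L → c + t < L → L + S ≡ suc span → t + S ≤ span ∸ c
choice-bounded c t S span L h e = subst (_≤ span ∸ c) (m+n∸m≡n c (t + S)) (∸-monoˡ-≤ c k)
  where
    k : c + (t + S) ≤ span
    k = ≤-pred (subst₂ _<_ (+-assoc c t S) e (+-monoˡ-< S h))

offset≤index : (c j : ℕ) → c ≤ 1 → (c ≡ 1 → j ≡ 0 → ⊥) → c ≤ j
offset≤index zero j _ _ = z≤n
offset≤index (suc zero) (suc j) _ _ = s≤s z≤n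
offset≤index (suc zero) zero _ h = ⊥-elim (h refl refl)
offset≤index (suc (suc c)) j (s≤s ()) _

record EncodingFacts (prof : Profile) (cs : List ℕ) : Set where
  field
    good : GoodFilling prof (encode prof cs)
    lin : Linked _<_ (splits prof cs)
    len : length (splits prof cs) + sum cs ≡ suc (span prof)
    chr⇒ : ∀ q → q ∈ splits prof cs → IsSplit q (concat (encode prof cs))
    chr⇐ : ∀ q → IsSplit q (concat (encode prof cs)) → q ∈ splits prof cs

encoding-facts : (prof : Profile) → RibbonProfile prof → (cs : List ℕ) → Admissible prof cs → EncodingFacts prof cs
encoding-facts ((m0 , c) ∷ []) wf .[] refl = record
  { good = (length-range 1 (suc m0) , range-increasing 1 (suc m0) , tt , tt) ,
           subst (λ w → w ↭ range 1 (length w)) (sym (++-identityʳ W0)) (subst (λ k → W0 ↭ range 1 k) (sym (length-range 1 (suc m0))) ↭-refl) ,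
           subst Avoids231 (sym (++-identityʳ W0)) (increasing⇒avoids W0 (range-increasing 1 (suc m0)))
  ; lin = range-increasing 0 (suc (suc m0))
  ; len = trans (+-identityʳ _) (length-range 0 (suc (suc m0)))
  ; chr⇒ = λ q m → subst (IsSplit q) (sym (++-identityʳ W0)) (range-splits q (suc m0) (≤-pred (proj₂ (range-∈⁻ 0 (suc (suc m0)) q m))))
  ; chr⇐ = λ q s → range-∈⁺ 0 (suc (suc m0)) q z≤n (s≤s (subst (q ≤_) (length-range 1 (suc m0)) (proj₁ (subst (IsSplit q) (++-identityʳ W0) s))))
  }
  where W0 = range 1 (suc m0)
encoding-facts ((m0 , c) ∷ (r ∷ prof)) (c≤1 ∷ wf) (t ∷ cs) (vcs , bd) = record
  { good = rows , subst (λ w → w ↭ range 1 (length w)) (sym eqW) inserted-perm , subst Avoids231 (sym eqW) (inserted-avoids av')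
  ; lin = inserted-splits-increasing L' IH.lin j j<L refl
  ; len = len'
  ; chr⇒ = λ q m → subst (IsSplit q) (sym eqW) (inserted-splits⇒ L' IH.lin j j<L refl IH.chr⇒ q m)
  ; chr⇐ = λ q s → inserted-splits⇐ L' IH.lin j j<L refl IH.chr⇐ q (subst (IsSplit q) eqW s)
  }
  where
    IH = encoding-facts (r ∷ prof) wf cs vcs
    module IH = EncodingFacts IH
    L' = splits (r ∷ prof) cs
    R' = encode (r ∷ prof) cs
    j = c + t
    j<L : j < length L'
    j<L = choice-within-splits c t (sum cs) (span (r ∷ prof)) (length L') bd (≤-trans c≤1 (span-pos r prof)) IH.len
    p = L' ‼ j
    rows' = proj₁ IH.good
    av' = proj₂ (proj₂ IH.good)
    open InsertBottomRow m0 p (concat R') (proj₁ (proj₂ IH.good)) (IH.chr⇒ p (‼-∈ L' j j<L))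
    eqW : concat (encode ((m0 , c) ∷ r ∷ prof) (t ∷ cs)) ≡ W
    eqW = cong (B ++_) (concat-map R')
    -- If c = 1 then j ≥ 1, so p ≥ 1 and the column condition with the row above holds.
    attached : (R'' : List (List ℕ)) → R'' ≡ R' → Attached c m0 B (map (map (lift m0 p)) R'')
    attached [] _ = tt
    attached ([] ∷ R'') e with subst (RowShape (r ∷ prof)) (sym e) rows'
    ... | () , _
    attached ((b ∷ B') ∷ R'') e c≡1 = subst (lift m0 p b <_) (sym (bottomRow-last m0 v))
      (first-below-v (≤-trans (subst (λ z → 1 ≤ z + t) (sym c≡1) (s≤s z≤n)) (increasing-‼≥index L' IH.lin j j<L)) b
        (subst (λ R → lookupM (concat R) 0 ≡ just b) e refl))
    rows : RowShape ((m0 , c) ∷ r ∷ prof) (encode ((m0 , c) ∷ r ∷ prof) (t ∷ cs))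
    rows = length-bottomRow m0 v , range-snoc-increasing 1 m0 v (s≤s (m≤m+n m0 p)) , attached R' refl ,
           rowShape-map (lift m0 p) (lift-mono-< m0 p) (r ∷ prof) R' rows'
    len' : length (range 0 (suc m0) ++ map (suc m0 +_) (drop j L')) + (t + sum cs) ≡ suc ((suc m0 ∸ c) + span (r ∷ prof))
    len' = trans (cong (_+ (t + sum cs)) (trans (length-++ (range 0 (suc m0))) (cong₂ _+_ (length-range 0 (suc m0)) (trans (length-map (suc m0 +_) (drop j L')) (length-drop j L')))))
             (splits-length-step (suc m0) c t (length L') (sum cs) (span (r ∷ prof)) IH.len (<⇒≤ j<L) (≤-trans c≤1 (s≤s z≤n)))

-- Completeness: every good filling of a nonempty ribbon profile encodes an admissible
-- sequence.  Peel off the bottom row, recurse, and locate p among the splits of the rest.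
encoding-complete : (prof : Profile) → 1 ≤ length prof → RibbonProfile prof → (R : List (List ℕ)) → GoodFilling prof R → Σ (List ℕ) λ cs → Admissible prof cs × R ≡ encode prof cs
encoding-complete ((m0 , c) ∷ []) _ wf (B ∷ []) ((lB , linB , _ , _) , perm , av) =
  [] , refl , cong [_] (trans (proj₁ (minimaPrefix-range B [] 1 _ (increasing⇒minimaPrefix B linB) perm)) (cong (range 1) lB))
encoding-complete ((m0 , c) ∷ (r ∷ prof)) _ (c≤1 ∷ wf) (B ∷ R') ((lB , linB , connB , rows') , perm , av) =
  t ∷ cs' , (vcs' , choice-bounded c t (sum cs') (span (r ∷ prof)) (length L') (subst (_< length L') (sym j≡) j<L) S.len) , cong₂ _∷_ Beq R'eq
  where
    open PeelBottomRow m0 B (concat R') lB linB perm av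
    R'' = map (map un) R'
    R'eq0 : map (map (lift m0 p)) R'' ≡ R'
    R'eq0 = map-map-inverse (lift m0 p) un R' lift-unlift
    W''eq : concat R'' ≡ map un (concat R')
    W''eq = concat-map R'
    rows'' : RowShape (r ∷ prof) R''
    rows'' = rowShape-unmap (lift m0 p) (lift-reflects-< m0 p) (r ∷ prof) R'' (subst (RowShape (r ∷ prof)) (sym R'eq0) rows')
    IH = encoding-complete (r ∷ prof) (s≤s z≤n) wf R''
           (rows'' , subst (λ w → w ↭ range 1 (length w)) (sym W''eq) unlifted-perm , subst Avoids231 (sym W''eq) unlifted-avoids)
    cs' = proj₁ IH
    vcs' = proj₁ (proj₂ IH)
    module S = EncodingFacts (encoding-facts (r ∷ prof) wf cs' vcs')
    L' = splits (r ∷ prof) cs'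
    splitOf : ∀ {q} → IsSplit q (map un (concat R')) → q ∈ L'
    splitOf {q} sq = S.chr⇐ q (subst (λ R → IsSplit q (concat R)) (proj₂ (proj₂ IH)) (subst (IsSplit q) (sym W''eq) sq))
    jr = ∈⇒lookupM L' p (splitOf p-split)
    j = proj₁ jr
    j<L = proj₁ (proj₂ jr)
    Lj : L' ‼ j ≡ p
    Lj = ‼-of-lookupM L' j p (proj₂ (proj₂ jr))
    -- If c = 1, p ≠ 0 by the column condition, while 0 is the first split; hence c ≤ j.
    c≤j : c ≤ j
    c≤j = offset≤index c j c≤1 λ c≡1 j≡0 →
      let (b , e , b<v) = attached-first-below r prof c m0 B R' rows' connB c≡1
          zeroSplit = zero-split (map un (concat R')) unlifted-perm
      in first-below⇒p≢0 b e b<v (trans (sym Lj) (trans (cong (L' ‼_) j≡0) (zero-is-head L' S.lin (splitOf zeroSplit))))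
    t = j ∸ c
    j≡ : c + t ≡ j
    j≡ = m+[n∸m]≡n c≤j
    p≡ : p ≡ L' ‼ (c + t)
    p≡ = sym (trans (cong (L' ‼_) j≡) Lj)
    Beq : B ≡ range 1 m0 ++ [ suc m0 + (L' ‼ (c + t)) ]
    Beq = trans bottom-row (cong (λ z → range 1 m0 ++ [ suc m0 + z ]) p≡)
    R'eq : R' ≡ map (map (lift m0 (L' ‼ (c + t)))) (encode (r ∷ prof) cs')
    R'eq = trans (sym R'eq0) (cong₂ (λ a b → map (map (lift m0 a)) b) p≡ (proj₂ (proj₂ IH)))

-- The encoding is injective on admissible sequences: the bottom rows determine the chosen
-- splits, and distinct split indices give distinct splits.
encoding-injective : (prof : Profile) → RibbonProfile prof → (cs1 cs2 : List ℕ) → Admissible prof cs1 → Admissible prof cs2 → encode prof cs1 ≡ encode prof cs2 → cs1 ≡ cs2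
encoding-injective ((m0 , c) ∷ []) wf .[] .[] refl refl e = refl
encoding-injective ((m0 , c) ∷ (r ∷ prof)) (c≤1 ∷ wf) (t1 ∷ c1) (t2 ∷ c2) (v1 , b1) (v2 , b2) e = cong₂ _∷_ t1≡t2 c1≡c2
  where
    L1 = splits (r ∷ prof) c1
    L2 = splits (r ∷ prof) c2
    p1 = L1 ‼ (c + t1)
    p2 = L2 ‼ (c + t2)
    hd = ∷-injectiveˡ e
    rest≡ = ∷-injectiveʳ e
    p≡ : p1 ≡ p2
    p≡ = +-cancelˡ-≡ (suc m0) _ _ (trans (sym (bottomRow-last m0 (suc m0 + p1))) (trans (cong (_‼ m0) hd) (bottomRow-last m0 (suc m0 + p2))))
    E≡ : encode (r ∷ prof) c1 ≡ encode (r ∷ prof) c2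
    E≡ = map-injective (map-injective (λ {x} {y} → lift-injective m0 p2 x y)) (subst (λ z → map (map (lift m0 z)) (encode (r ∷ prof) c1) ≡ _) p≡ rest≡)
    c1≡c2 : c1 ≡ c2
    c1≡c2 = encoding-injective (r ∷ prof) wf c1 c2 v1 v2 E≡
    S = encoding-facts (r ∷ prof) wf c1 v1
    module S = EncodingFacts S
    H' = span (r ∷ prof)
    j1 = choice-within-splits c t1 (sum c1) H' (length L1) b1 (≤-trans c≤1 (span-pos r prof)) S.len
    j2 = choice-within-splits c t2 (sum c1) H' (length L1) (subst (λ z → t2 + sum z ≤ H' ∸ c) (sym c1≡c2) b2) (≤-trans c≤1 (span-pos r prof)) S.len
    t1≡t2 : t1 ≡ t2
    t1≡t2 = +-cancelˡ-≡ c _ _ (increasing-‼-injective L1 S.lin (c + t1) (c + t2) j1 j2 (trans p≡ (cong (λ z → splits (r ∷ prof) z ‼ (c + t2)) (sym c1≡c2))))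

choiceBlock : ℕ → ℕ → List ℕ → List (List ℕ)
choiceBlock b c cs = map (λ t → t ∷ cs) (upTo (suc (b ∸ c) ∸ sum cs))

admissibles : Profile → List (List ℕ)
admissibles [] = []
admissibles (_ ∷ []) = [ [] ]
admissibles ((m0 , c) ∷ (r ∷ prof)) = concat (map (choiceBlock (span (r ∷ prof)) c) (admissibles (r ∷ prof)))

choice-bound⁻ : ∀ t S b → t < suc b ∸ S → t + S ≤ b
choice-bound⁻ t S b h = subst (_≤ b) (+-comm S t) (≤-pred (subst (suc (S + t) ≤_) (m+[n∸m]≡n S≤) (+-monoʳ-< S h)))
  where
    S≤ : S ≤ suc b
    S≤ with S ≤? suc b
    ... | yes q = q
    ... | no q = ⊥-elim (<⇒≱ (subst (t <_) (m≤n⇒m∸n≡0 (<⇒≤ (≰⇒> q))) h) z≤n)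

choice-bound⁺ : ∀ t S b → t + S ≤ b → t < suc b ∸ S
choice-bound⁺ t S b h = subst (t <_) (sym (+-∸-assoc 1 (m+n≤o⇒n≤o t h))) (s≤s (subst (_≤ b ∸ S) (m+n∸n≡m t S) (∸-monoˡ-≤ S h)))

admissibles-sound : (prof : Profile) (cs : List ℕ) → cs ∈ admissibles prof → Admissible prof cs
admissibles-sound ((m0 , c) ∷ []) .[] (here refl) = refl
admissibles-sound ((m0 , c) ∷ (r ∷ prof)) cs m with ∈-concat⁻′ (map (choiceBlock (span (r ∷ prof)) c) (admissibles (r ∷ prof))) m
... | xs , m1 , m2 with ∈-map⁻ (choiceBlock (span (r ∷ prof)) c) m2
...   | cs' , m3 , refl with ∈-map⁻ (λ t → t ∷ cs') m1
...     | t , m4 , refl = admissibles-sound (r ∷ prof) cs' m3 , choice-bound⁻ t (sum cs') _ (upTo-∈⁻ _ t m4)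

admissibles-complete : (prof : Profile) (cs : List ℕ) → Admissible prof cs → cs ∈ admissibles prof
admissibles-complete ((m0 , c) ∷ []) .[] refl = here refl
admissibles-complete ((m0 , c) ∷ (r ∷ prof)) (t ∷ cs) (v , b) =
  ∈-concat⁺′ (∈-map⁺ (λ t → t ∷ cs) (upTo-∈⁺ _ t (choice-bound⁺ t (sum cs) _ b))) (∈-map⁺ (choiceBlock (span (r ∷ prof)) c) (admissibles-complete (r ∷ prof) cs v))

blocks-disjoint : (f : List ℕ → List (List ℕ)) → (∀ x y z → z ∈ f x → z ∈ f y → x ≡ y) →
              (xs : List (List ℕ)) → Unique xs → AllPairs Disjoint (map f xs)
blocks-disjoint f h [] u = []
blocks-disjoint f h (x ∷ xs) (a ∷ u) = disjoint-from xs a ∷ blocks-disjoint f h xs u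
  where
    disjoint-from : (ys : List (List ℕ)) → All (x ≢_) ys → All (Disjoint (f x)) (map f ys)
    disjoint-from [] [] = []
    disjoint-from (y ∷ ys) (ne ∷ nes) = (λ {v} (m1 , m2) → ne (h x y v m1 m2)) ∷ disjoint-from ys nes

admissibles-unique : (prof : Profile) → Unique (admissibles prof)
admissibles-unique [] = []
admissibles-unique ((m0 , c) ∷ []) = [] ∷ []
admissibles-unique ((m0 , c) ∷ (r ∷ prof)) = UP.concat⁺ (blocks-unique (admissibles (r ∷ prof))) (blocks-disjoint (choiceBlock (span (r ∷ prof)) c) same-block (admissibles (r ∷ prof)) (admissibles-unique (r ∷ prof)))
  where
    blocks-unique : (xs : List (List ℕ)) → All Unique (map (choiceBlock (span (r ∷ prof)) c) xs)
    blocks-unique [] = []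
    blocks-unique (cs ∷ xs) = UP.map⁺ (λ e → ∷-injectiveˡ e) (subst Unique (sym (upTo-range _)) (Unique-range 0 _)) ∷ blocks-unique xs
    same-block : ∀ x y z → z ∈ choiceBlock (span (r ∷ prof)) c x → z ∈ choiceBlock (span (r ∷ prof)) c y → x ≡ y
    same-block x y z m1 m2 with ∈-map⁻ (λ t → t ∷ x) m1 | ∈-map⁻ (λ t → t ∷ y) m2
    ... | _ , _ , refl | _ , _ , e = ∷-injectiveʳ e

suffixSums : List ℕ → List ℕ
suffixSums [] = []
suffixSums (t ∷ cs) = (t + sum cs) ∷ suffixSums cs

consPositive : ℕ → List ℕ → List ℕ
consPositive zero _ = []
consPositive (suc k) xs = suc k ∷ xs

toPartition : List ℕ → List ℕ
toPartition [] = []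
toPartition (t ∷ cs) = consPositive (t + sum cs) (toPartition cs)

bounds : Profile → List ℕ
bounds [] = []
bounds (_ ∷ []) = []
bounds ((m0 , c) ∷ (r ∷ prof)) = (span (r ∷ prof) ∸ c) ∷ bounds (r ∷ prof)

suffixSums-≤-sum : (cs : List ℕ) (r : ℕ) → suffixSums cs ‼ r ≤ sum cs
suffixSums-≤-sum [] r = z≤n
suffixSums-≤-sum (t ∷ cs) zero = ≤-refl
suffixSums-≤-sum (t ∷ cs) (suc r) = ≤-trans (suffixSums-≤-sum cs r) (m≤n+m _ t)

suffixSums-decreasing : (cs : List ℕ) (r : ℕ) → suffixSums cs ‼ suc r ≤ suffixSums cs ‼ r
suffixSums-decreasing [] r = z≤n
suffixSums-decreasing (t ∷ cs) zero = ≤-trans (suffixSums-≤-sum cs 0) (m≤n+m _ t)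
suffixSums-decreasing (t ∷ cs) (suc r) = suffixSums-decreasing cs r

toPartition-‼ : (cs : List ℕ) (r : ℕ) → toPartition cs ‼ r ≡ suffixSums cs ‼ r
toPartition-‼ [] r = refl
toPartition-‼ (t ∷ cs) r with t + sum cs in eq
toPartition-‼ (t ∷ cs) zero | zero = refl
toPartition-‼ (t ∷ cs) (suc r) | zero = sym (n≤0⇒n≡0 (≤-trans (suffixSums-≤-sum cs r) (≤-trans (m≤n+m _ t) (≤-reflexive eq))))
toPartition-‼ (t ∷ cs) zero | suc k = refl
toPartition-‼ (t ∷ cs) (suc r) | suc k = toPartition-‼ cs r

toPartition-positive : (cs : List ℕ) → All (0 <_) (toPartition cs)
toPartition-positive [] = []
toPartition-positive (t ∷ cs) with t + sum cs
... | zero = []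
... | suc k = s≤s z≤n ∷ toPartition-positive cs

toPartition-isPartition : (cs : List ℕ) → IsPartition (toPartition cs)
toPartition-isPartition cs = ‼-decreasing⇒sorted (toPartition cs) (λ r → subst₂ _≤_ (sym (toPartition-‼ cs (suc r))) (sym (toPartition-‼ cs r)) (suffixSums-decreasing cs r)) , toPartition-positive cs

admissible⇒bounded : (prof : Profile) (cs : List ℕ) → Admissible prof cs → length cs ≡ length (bounds prof) × (∀ r → suffixSums cs ‼ r ≤ bounds prof ‼ r)
admissible⇒bounded ((m0 , c) ∷ []) .[] refl = refl , (λ r → z≤n)
admissible⇒bounded ((m0 , c) ∷ (r ∷ prof)) (t ∷ cs) (v , b) with admissible⇒bounded (r ∷ prof) cs v
... | l , h = cong suc l , λ { zero → b ; (suc i) → h i }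

bounded⇒admissible : (prof : Profile) → 1 ≤ length prof → (cs : List ℕ) → length cs ≡ length (bounds prof) → (∀ r → suffixSums cs ‼ r ≤ bounds prof ‼ r) → Admissible prof cs
bounded⇒admissible ((m0 , c) ∷ []) _ [] l h = refl
bounded⇒admissible ((m0 , c) ∷ (r ∷ prof)) _ (t ∷ cs) l h = bounded⇒admissible (r ∷ prof) (s≤s z≤n) cs (suc-injective l) (λ i → h (suc i)) , h 0

-- differences K ρ: the K consecutive differences of ρ, inverse to suffixSums.
differences : ℕ → List ℕ → List ℕ
differences zero ρ = []
differences (suc K) ρ = (ρ ‼ 0 ∸ ρ ‼ 1) ∷ differences K (tail ρ)

length-differences : ∀ K ρ → length (differences K ρ) ≡ K
length-differences zero ρ = refl
length-differences (suc K) ρ = cong suc (length-differences K (tail ρ))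

sum-differences : ∀ K ρ → Linked (λ a b → b ≤ a) ρ → length ρ ≤ K → sum (differences K ρ) ≡ ρ ‼ 0
sum-differences zero [] l _ = refl
sum-differences (suc K) ρ l lρ = trans (cong ((ρ ‼ 0 ∸ ρ ‼ 1) +_) (trans (sum-differences K (tail ρ) (tail-sorted ρ l) (length-tail≤ ρ lρ)) (tail-‼ ρ 0))) (m∸n+n≡m (sorted⇒‼-decreasing ρ l 0))

suffixSums-differences : ∀ K ρ → Linked (λ a b → b ≤ a) ρ → length ρ ≤ K → ∀ r → suffixSums (differences K ρ) ‼ r ≡ ρ ‼ r
suffixSums-differences zero [] l _ r = refl
suffixSums-differences (suc K) ρ l lρ zero = sum-differences (suc K) ρ l lρ
suffixSums-differences (suc K) ρ l lρ (suc r) = trans (suffixSums-differences K (tail ρ) (tail-sorted ρ l) (length-tail≤ ρ lρ) r) (tail-‼ ρ r)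

suffixSums-injective : (c1 c2 : List ℕ) → length c1 ≡ length c2 → suffixSums c1 ≡ suffixSums c2 → c1 ≡ c2
suffixSums-injective [] [] _ _ = refl
suffixSums-injective (t1 ∷ c1) (t2 ∷ c2) l e with ∷-injective e
... | eh , et with suffixSums-injective c1 c2 (suc-injective l) et
... | refl = cong (_∷ c1) (+-cancelʳ-≡ (sum c1) t1 t2 eh)

length-suffixSums : (cs : List ℕ) → length (suffixSums cs) ≡ length cs
length-suffixSums [] = refl
length-suffixSums (t ∷ cs) = cong suc (length-suffixSums cs)

toPartition-injective : (c1 c2 : List ℕ) → length c1 ≡ length c2 → toPartition c1 ≡ toPartition c2 → c1 ≡ c2
toPartition-injective c1 c2 l e = suffixSums-injective c1 c2 l (length-‼-ext (suffixSums c1) (suffixSums c2) (trans (length-suffixSums c1) (trans l (sym (length-suffixSums c2))))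
  (λ r → trans (sym (toPartition-‼ c1 r)) (trans (cong (_‼ r) e) (toPartition-‼ c2 r))))

partitions-enumerated : (prof : Profile) → 1 ≤ length prof → (ν : List ℕ) → (∀ r → ν ‼ r ≡ bounds prof ‼ r) →
            ∀ ρ → (ρ ∈ map toPartition (admissibles prof)) ⇔ PartitionIn ν ρ
partitions-enumerated prof ne ν hν ρ = mk⇔ to from
  where
    to : ρ ∈ map toPartition (admissibles prof) → PartitionIn ν ρ
    to m with ∈-map⁻ toPartition m
    ... | cs , mc , refl = toPartition-isPartition cs , λ r → subst₂ _≤_ (sym (toPartition-‼ cs r)) (sym (hν r)) (proj₂ (admissible⇒bounded prof cs (admissibles-sound prof cs mc)) r)
    from : PartitionIn ν ρ → ρ ∈ map toPartition (admissibles prof)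
    from ((lin , pos) , bd) = subst (_∈ map toPartition (admissibles prof)) tpeq (∈-map⁺ toPartition (admissibles-complete prof cs vcs))
      where
        K = length (bounds prof)
        lρ : length ρ ≤ K
        lρ with length ρ ≤? K
        ... | yes h = h
        ... | no h = ⊥-elim (<⇒≱ (‼-positive ρ pos K (≰⇒> h)) (≤-trans (bd K) (≤-reflexive (trans (hν K) (‼-beyond-length (bounds prof) K ≤-refl)))))
        cs = differences K ρ
        vcs : Admissible prof cs
        vcs = bounded⇒admissible prof ne cs (length-differences K ρ) (λ r → subst₂ _≤_ (sym (suffixSums-differences K ρ lin lρ r)) (hν r) (bd r))
        tpeq : toPartition cs ≡ ρ
        tpeq = positive-‼-ext (toPartition cs) ρ (toPartition-positive cs) pos (λ r → trans (toPartition-‼ cs r) (suffixSums-differences K ρ lin lρ r))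

RowConditions : Profile → List (List ℕ) → Set
RowConditions prof R = ∀ i m0 c B → lookupM prof i ≡ just (m0 , c) → lookupM R i ≡ just B →
  length B ≡ suc m0 × Linked _<_ B × (∀ B' → lookupM R (suc i) ≡ just B' → c ≡ 1 → B' ‼ 0 < B ‼ m0)

rowConditions⇒rowShape : (prof : Profile) (R : List (List ℕ)) → length R ≡ length prof → RowConditions prof R → RowShape prof R
rowConditions⇒rowShape [] [] _ _ = tt
rowConditions⇒rowShape ((m0 , c) ∷ prof) (B ∷ R) l h with h 0 m0 c B refl refl
... | lB , linB , cn = lB , linB , cn' R (λ B' e → cn B' e) , rowConditions⇒rowShape prof R (suc-injective l) (λ i → h (suc i))
  where
    cn' : ∀ R → (∀ B' → lookupM (B ∷ R) 1 ≡ just B' → c ≡ 1 → B' ‼ 0 < B ‼ m0) → Attached c m0 B R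
    cn' [] _ = tt
    cn' (B' ∷ R) f = f B' refl

rowShape⇒rowConditions : (prof : Profile) (R : List (List ℕ)) → RowShape prof R → length R ≡ length prof × RowConditions prof R
rowShape⇒rowConditions [] [] _ = refl , λ i m0 c B ()
rowShape⇒rowConditions ((m0 , c) ∷ prof) (B ∷ R) (lB , linB , cn , rs) with rowShape⇒rowConditions prof R rs
... | l , h = cong suc l , hh
  where
    hh : RowConditions ((m0 , c) ∷ prof) (B ∷ R)
    hh zero .m0 .c .B refl refl = lB , linB , cn' R cn
      where
        cn' : ∀ R → Attached c m0 B R → ∀ B' → lookupM (B ∷ R) 1 ≡ just B' → c ≡ 1 → B' ‼ 0 < B ‼ m0
        cn' (B'' ∷ R) f .B'' refl = f
    hh (suc i) = h i

span-step : ∀ a b l L → a ≤ b → b ≤ l → l ≤ L → (l ∸ a) ∸ (l ∸ b) + (L ∸ b) ≡ L ∸ a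
span-step a b l L ab bl lL = goal
  where
    x = b ∸ a
    y = l ∸ b
    z = L ∸ l
    beq : b ≡ a + x
    beq = sym (m+[n∸m]≡n ab)
    leq : l ≡ b + y
    leq = sym (m+[n∸m]≡n bl)
    Leq : L ≡ l + z
    Leq = sym (m+[n∸m]≡n lL)
    la' : l ∸ a ≡ y + x
    la' = trans (cong (_∸ a) (trans leq (cong (_+ y) beq))) (trans (cong (_∸ a) (solve 3 (λ a x y → (a :+ x) :+ y := a :+ (y :+ x)) refl a x y)) (m+n∸m≡n a (y + x)))
    Lb : L ∸ b ≡ y + z
    Lb = trans (cong (_∸ b) (trans Leq (cong (_+ z) leq))) (trans (cong (_∸ b) (+-assoc b y z)) (m+n∸m≡n b (y + z)))
    La : L ∸ a ≡ x + (y + z)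
    La = trans (cong (_∸ a) (trans Leq (trans (cong (_+ z) leq) (cong (λ w → w + y + z) beq)))) (trans (cong (_∸ a) (solve 4 (λ a x y z → ((a :+ x) :+ y) :+ z := a :+ (x :+ (y :+ z))) refl a x y z)) (m+n∸m≡n a (x + (y + z))))
    goal : (l ∸ a) ∸ (l ∸ b) + (L ∸ b) ≡ L ∸ a
    goal = trans (cong₂ _+_ (trans (cong (_∸ y) la') (m+n∸m≡n y x)) Lb) (sym La)

span-minus-overhang : ∀ b l L → b ≤ l → l ≤ L → (L ∸ b) ∸ (l ∸ b) ≡ L ∸ l
span-minus-overhang b l L bl lL = trans (cong (_∸ (l ∸ b)) Lb) (m+n∸m≡n (l ∸ b) (L ∸ l))
  where
    Lb : L ∸ b ≡ (l ∸ b) + (L ∸ l)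
    Lb = trans (cong (_∸ b) (trans (sym (m+[n∸m]≡n lL)) (cong (_+ (L ∸ l)) (sym (m+[n∸m]≡n bl))))) (trans (cong (_∸ b) (+-assoc b (l ∸ b) (L ∸ l))) (m+n∸m≡n b _))

-- Under the boundary condition every row of λ/μ is nonempty and
-- row r+1 reaches at least to column μ_r; the overhang λ_{r+1} - μ_r counts the columns
-- shared by rows r and r+1, so λ/μ is a ribbon iff all overhangs are ≤ 1.  Its profile
-- lists the rows bottom-up, and tableaux correspond to good fillings of the profile.
module SkewShape (la μ : List ℕ) (pla : IsPartition la) (pμ : IsPartition μ) (sub : μ ⊆ᵖ la) (bc : BoundaryCond la μ) where
  k = length la

  overhang : ℕ → ℕ
  overhang zero = 0
  overhang (suc r) = la ‼ suc r ∸ μ ‼ r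

  -- Row r has λ_r - μ_r = m0 + 1 boxes; the profile lists rows k-1, …, 0 (bottom first).
  rowProfile : ℕ → ℕ × ℕ
  rowProfile r = (la ‼ r ∸ suc (μ ‼ r) , overhang r)

  profileUpTo : ℕ → Profile
  profileUpTo zero = []
  profileUpTo (suc r) = rowProfile r ∷ profileUpTo r

  prof = profileUpTo k

  -- Index i of the profile describes row k-1-i.
  length-profileUpTo : ∀ n → length (profileUpTo n) ≡ n
  length-profileUpTo zero = refl
  length-profileUpTo (suc n) = cong suc (length-profileUpTo n)

  lookupM-profileUpTo : ∀ n i → i < n → lookupM (profileUpTo n) i ≡ just (rowProfile (n ∸ suc i))
  lookupM-profileUpTo (suc n) zero _ = refl
  lookupM-profileUpTo (suc n) (suc i) (s≤s h) = lookupM-profileUpTo n i h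

  row-nonempty : ∀ r → r < k → μ ‼ r < la ‼ r
  row-nonempty r h with r <? length μ
  ... | yes q = proj₂ (proj₁ bc r q)
  ... | no q = subst (_< la ‼ r) (sym (‼-beyond-length μ r (≮⇒≥ q))) (‼-positive la (proj₂ pla) r h)

  la-decreasing : ∀ r → la ‼ suc r ≤ la ‼ r
  la-decreasing = sorted⇒‼-decreasing la (proj₁ pla)

  μ-decreasing : ∀ r → μ ‼ suc r ≤ μ ‼ r
  μ-decreasing = sorted⇒‼-decreasing μ (proj₁ pμ)

  la-≤-first : ∀ r → la ‼ r ≤ la ‼ 0
  la-≤-first zero = ≤-refl
  la-≤-first (suc r) = ≤-trans (la-decreasing r) (la-≤-first r)

  rows-adjacent : ∀ r → μ ‼ r ≤ la ‼ suc r
  rows-adjacent r with μ ‼ suc r <? μ ‼ r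
  ... | yes q = ≤-trans (≤-reflexive (sym (m+[n∸m]≡n μr≥1))) (proj₂ (proj₂ bc r (μ ‼ r ∸ 1) (≤-pred (subst (μ ‼ suc r <_) (sym (m+[n∸m]≡n μr≥1)) q)) (subst (μ ‼ r ∸ 1 <_) (m+[n∸m]≡n μr≥1) ≤-refl)))
    where
      μr≥1 : 1 ≤ μ ‼ r
      μr≥1 = ≤-trans (s≤s z≤n) q
  ... | no q = ≤-trans (≮⇒≥ q) (sub (suc r))

  ribbon-overlap≤1 : No2x2 la μ → ∀ r → suc r < k → la ‼ suc r ≤ suc (μ ‼ r)
  ribbon-overlap≤1 no2 r h with la ‼ suc r ≤? suc (μ ‼ r)
  ... | yes q = q
  ... | no q = ⊥-elim (no2 r (μ ‼ r) (s1 , s2 , s3 , s4))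
    where
      big : suc (suc (μ ‼ r)) ≤ la ‼ suc r
      big = ≰⇒> q
      s1 : InSkew la μ r (μ ‼ r)
      s1 = ≤-refl , row-nonempty r (<-trans (n<1+n r) h)
      s2 : InSkew la μ r (suc (μ ‼ r))
      s2 = n≤1+n _ , ≤-trans big (la-decreasing r)
      s3 : InSkew la μ (suc r) (μ ‼ r)
      s3 = μ-decreasing r , ≤-trans (n≤1+n _) big
      s4 : InSkew la μ (suc r) (suc (μ ‼ r))
      s4 = ≤-trans (μ-decreasing r) (n≤1+n _) , big

  TableauRows : List (List ℕ) → Set
  TableauRows T = length T ≡ k ×
    (∀ r B → lookupM T r ≡ just B → length B ≡ la ‼ r ∸ μ ‼ r × Linked _<_ B ×
       (∀ r' B' → r ≡ suc r' → lookupM T r' ≡ just B' → overhang r ≡ 1 → B' ‼ 0 < B ‼ (la ‼ r ∸ suc (μ ‼ r))))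

  tableauRows⇒rowShape : (T : List (List ℕ)) → TableauRows T → RowShape prof (reverse T)
  tableauRows⇒rowShape T (lT , h) = rowConditions⇒rowShape prof (reverse T) (trans (length-reverse T) (trans lT (sym (length-profileUpTo k)))) cond
    where
      cond : RowConditions prof (reverse T)
      cond i m0 c B e1 e2 = subst (λ z → length B ≡ suc z) m0eq lB' , linB , cn
        where
          i<k : i < k
          i<k = subst (i <_) (length-profileUpTo k) (lookupM⇒<length prof i _ e1)
          r = k ∸ suc i
          r<k : r < k
          r<k = ∸-monoʳ-< {k} {suc i} {0} (s≤s z≤n) i<k
          rs : (m0 , c) ≡ rowProfile r
          rs = just-injective (trans (sym e1) (lookupM-profileUpTo k i i<k))
          m0eq : la ‼ r ∸ suc (μ ‼ r) ≡ m0
          m0eq = cong proj₁ (sym rs)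
          ceq : overhang r ≡ c
          ceq = cong proj₂ (sym rs)
          eT : lookupM T r ≡ just B
          eT = trans (sym (lookupM-reverse-rows T lT i i<k)) e2
          hr = h r B eT
          lB' : length B ≡ suc (la ‼ r ∸ suc (μ ‼ r))
          lB' = trans (proj₁ hr) (∸-suc (la ‼ r) (μ ‼ r) (row-nonempty r r<k))
          linB = proj₁ (proj₂ hr)
          cn : ∀ B' → lookupM (reverse T) (suc i) ≡ just B' → c ≡ 1 → B' ‼ 0 < B ‼ m0
          cn B' e3 c1 = subst (λ z → B' ‼ 0 < B ‼ z) m0eq (proj₂ (proj₂ hr) r' B' req eT' (trans ceq c1))
            where
              si<k : suc i < k
              si<k = subst (suc i <_) lT (subst (suc i <_) (length-reverse T) (lookupM⇒<length (reverse T) (suc i) B' e3))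
              r' = k ∸ suc (suc i)
              req : r ≡ suc r'
              req = ∸-suc k (suc i) si<k
              eT' : lookupM T r' ≡ just B'
              eT' = trans (sym (lookupM-reverse-rows T lT (suc i) si<k)) e3

  rowShape⇒tableauRows : (T : List (List ℕ)) → RowShape prof (reverse T) → TableauRows T
  rowShape⇒tableauRows T rs with rowShape⇒rowConditions prof (reverse T) rs
  ... | lR , h = lT , cond
    where
      lT : length T ≡ k
      lT = trans (sym (length-reverse T)) (trans lR (length-profileUpTo k))
      cond : ∀ r B → lookupM T r ≡ just B → length B ≡ la ‼ r ∸ μ ‼ r × Linked _<_ B ×
               (∀ r' B' → r ≡ suc r' → lookupM T r' ≡ just B' → overhang r ≡ 1 → B' ‼ 0 < B ‼ (la ‼ r ∸ suc (μ ‼ r)))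
      cond r B e = trans lB (sym (∸-suc (la ‼ r) (μ ‼ r) (row-nonempty r r<k))) , linB , cn
        where
          r<k : r < k
          r<k = subst (r <_) lT (lookupM⇒<length T r B e)
          i = k ∸ suc r
          i<k : i < k
          i<k = ∸-monoʳ-< {k} {suc r} {0} (s≤s z≤n) r<k
          ri : k ∸ suc i ≡ r
          ri = ∸-∸-suc k r r<k
          e1 : lookupM prof i ≡ just (rowProfile r)
          e1 = trans (lookupM-profileUpTo k i i<k) (cong (λ z → just (rowProfile z)) ri)
          e2 : lookupM (reverse T) i ≡ just B
          e2 = trans (lookupM-reverse-rows T lT i i<k) (trans (cong (lookupM T) ri) e)
          hh = h i _ _ B e1 e2
          lB = proj₁ hh
          linB = proj₁ (proj₂ hh)
          cn : ∀ r' B' → r ≡ suc r' → lookupM T r' ≡ just B' → overhang r ≡ 1 → B' ‼ 0 < B ‼ (la ‼ r ∸ suc (μ ‼ r))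
          cn r' B' refl e' c1 = proj₂ (proj₂ hh) B' e3 c1
            where
              si<k : suc i < k
              si<k = subst (_< k) (∸-suc k (suc r') r<k) (∸-monoʳ-< {k} {suc r'} {0} (s≤s z≤n) (<⇒≤ r<k))
              e3 : lookupM (reverse T) (suc i) ≡ just B'
              e3 = trans (lookupM-reverse-rows T lT (suc i) si<k)
                     (trans (cong (lookupM T) (trans (cong (λ z → k ∸ suc z) (sym (∸-suc k (suc r') r<k))) (∸-∸-suc k r' (<-trans (n<1+n r') r<k)))) e')

  lookupM-rowLengths : ∀ r → r < k → lookupM (rowLengths la μ) r ≡ just (la ‼ r ∸ μ ‼ r)
  lookupM-rowLengths r h = lookupM-map⁺ (λ r → la ‼ r ∸ μ ‼ r) (upTo k) r r (lookupM-upTo k r h)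

  length-rowLengths : length (rowLengths la μ) ≡ k
  length-rowLengths = trans (length-map _ (upTo k)) (length-upTo k)

  rows-count : (T : List (List ℕ)) → map length T ≡ rowLengths la μ → length T ≡ k
  rows-count T lens = trans (sym (length-map length T)) (trans (cong length lens) length-rowLengths)

  row-length : (T : List (List ℕ)) → map length T ≡ rowLengths la μ → ∀ r B → lookupM T r ≡ just B → length B ≡ la ‼ r ∸ μ ‼ r
  row-length T lens r B e = just-injective (trans (sym (lookupM-map⁺ length T r B e))
    (trans (cong (λ z → lookupM z r) lens) (lookupM-rowLengths r (subst (r <_) (rows-count T lens) (lookupM⇒<length T r B e)))))

  -- A standard tableau satisfies TableauRows, and conversely for a ribbon, where the only
  -- column conditions are between the last box of a row and the first box of the next.
  syt⇒tableauRows : (T : List (List ℕ)) → IsSYT la μ T → TableauRows T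
  syt⇒tableauRows T (lens , perm , rowc , colc) = lT , cond
    where
      lT = rows-count T lens
      lenB = row-length T lens
      cond : ∀ r B → lookupM T r ≡ just B → length B ≡ la ‼ r ∸ μ ‼ r × Linked _<_ B ×
               (∀ r' B' → r ≡ suc r' → lookupM T r' ≡ just B' → overhang r ≡ 1 → B' ‼ 0 < B ‼ (la ‼ r ∸ suc (μ ‼ r)))
      cond r B e = lenB r B e , lookupM-increasing B lk , cn
        where
          lk : ∀ i x y → lookupM B i ≡ just x → lookupM B (suc i) ≡ just y → x < y
          lk i x y ex ey = rowc r (μ ‼ r + i) x y (B , e , m≤m+n _ i , subst (λ z → lookupM B z ≡ just x) (sym (m+n∸m≡n (μ ‼ r) i)) ex)
                                                  (B , e , ≤-trans (m≤m+n _ i) (n≤1+n _) , subst (λ z → lookupM B z ≡ just y) (sym (trans (cong (_∸ μ ‼ r) (sym (+-suc (μ ‼ r) i))) (m+n∸m≡n (μ ‼ r) (suc i)))) ey)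
          cn : ∀ r' B' → r ≡ suc r' → lookupM T r' ≡ just B' → overhang r ≡ 1 → B' ‼ 0 < B ‼ (la ‼ r ∸ suc (μ ‼ r))
          cn r' B' refl e' c1 = subst (λ z → B' ‼ 0 < B ‼ z) idx (colc r' (μ ‼ r') (B' ‼ 0) (B ‼ (μ ‼ r' ∸ μ ‼ r)) at1 at2)
            where
              laeq : la ‼ r ≡ suc (μ ‼ r')
              laeq = ∸≡1 _ _ c1
              r<k : r < k
              r<k = subst (r <_) lT (lookupM⇒<length T r B e)
              idx : μ ‼ r' ∸ μ ‼ r ≡ la ‼ r ∸ suc (μ ‼ r)
              idx = cong (_∸ suc (μ ‼ r)) (sym laeq)
              lB' : 0 < length B'
              lB' = subst (0 <_) (sym (lenB r' B' e')) (m<n⇒0<n∸m (row-nonempty r' (<-trans (n<1+n r') r<k)))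
              at1 : At μ T r' (μ ‼ r') (B' ‼ 0)
              at1 = B' , e' , ≤-refl , subst (λ z → lookupM B' z ≡ just (B' ‼ 0)) (sym (n∸n≡0 (μ ‼ r'))) (lookupM-‼ B' 0 lB')
              m0<B : μ ‼ r' ∸ μ ‼ r < length B
              m0<B = subst (μ ‼ r' ∸ μ ‼ r <_) (sym (trans (lenB r B e) (cong (_∸ μ ‼ r) laeq)))
                       (≤-reflexive (sym (+-∸-assoc 1 (μ-decreasing r'))))
              at2 : At μ T r (μ ‼ r') (B ‼ (μ ‼ r' ∸ μ ‼ r))
              at2 = B , e , μ-decreasing r' , lookupM-‼ B _ m0<B

  tableauRows⇒syt : No2x2 la μ → (T : List (List ℕ)) → TableauRows T → concat T ↭ map suc (upTo (length (concat T))) → IsSYT la μ T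
  tableauRows⇒syt no2 T (lT , h) perm = lens , perm , rowc , colc
    where
      lens : map length T ≡ rowLengths la μ
      lens = lookupM-ext _ _ f
        where
          f : ∀ i → lookupM (map length T) i ≡ lookupM (rowLengths la μ) i
          f i with i <? k
          ... | yes ik = let (B , e) = lookupM-defined T i (subst (i <_) (sym lT) ik) in
                 trans (lookupM-map⁺ length T i B e) (trans (cong just (proj₁ (h i B e))) (sym (lookupM-rowLengths i ik)))
          ... | no ik = trans (lookupM-beyond (map length T) i (subst (_≤ i) (sym (trans (length-map length T) lT)) (≮⇒≥ ik)))
                          (sym (lookupM-beyond (rowLengths la μ) i (subst (_≤ i) (sym length-rowLengths) (≮⇒≥ ik))))
      rowc : ∀ r c a b → At μ T r c a → At μ T r (suc c) b → a < b
      rowc r c a b (B₁ , e1 , le1 , ea) (B2 , e2 , le2 , eb) with trans (sym e1) e2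
      ... | refl = increasing-lookupM B₁ (proj₁ (proj₂ (h r B₁ e1))) (c ∸ μ ‼ r) (suc c ∸ μ ‼ r) a b
                       (subst (c ∸ μ ‼ r <_) (sym (+-∸-assoc 1 le1)) ≤-refl) ea eb
      colc : ∀ r c a b → At μ T r c a → At μ T (suc r) c b → a < b
      colc r c a b (B₁ , e1 , le1 , ea) (B2 , e2 , le2 , eb) = subst₂ _<_ a≡ b≡ conn
        where
          sr<k : suc r < k
          sr<k = subst (suc r <_) lT (lookupM⇒<length T (suc r) B2 e2)
          h2 = h (suc r) B2 e2
          c<L : c < la ‼ suc r
          c<L = <-∸-cancel le2 (subst (c ∸ μ ‼ suc r <_) (proj₁ h2) (lookupM⇒<length B2 _ b eb))
          hi = ribbon-overlap≤1 no2 r sr<k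
          c≡ : c ≡ μ ‼ r
          c≡ = ≤-antisym (≤-pred (≤-trans c<L hi)) le1
          L≡ : la ‼ suc r ≡ suc (μ ‼ r)
          L≡ = ≤-antisym hi (subst (_< la ‼ suc r) c≡ c<L)
          cu1 : overhang (suc r) ≡ 1
          cu1 = trans (cong (_∸ μ ‼ r) L≡) (trans (+-∸-assoc 1 {μ ‼ r} ≤-refl) (cong suc (n∸n≡0 (μ ‼ r))))
          conn : B₁ ‼ 0 < B2 ‼ (la ‼ suc r ∸ suc (μ ‼ suc r))
          conn = proj₂ (proj₂ h2) r B₁ refl e1 cu1
          a≡ : B₁ ‼ 0 ≡ a
          a≡ = ‼-of-lookupM B₁ 0 a (subst (λ z → lookupM B₁ z ≡ just a) (trans (cong (_∸ μ ‼ r) c≡) (n∸n≡0 (μ ‼ r))) ea)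
          b≡ : B2 ‼ (la ‼ suc r ∸ suc (μ ‼ suc r)) ≡ b
          b≡ = ‼-of-lookupM B2 _ b (subst (λ z → lookupM B2 z ≡ just b) (trans (cong (_∸ μ ‼ suc r) c≡) (cong (_∸ suc (μ ‼ suc r)) (sym L≡))) eb)

  span-profile : ∀ r → r < k → span (profileUpTo (suc r)) ≡ la ‼ 0 ∸ μ ‼ r
  span-profile zero h = sym (∸-suc (la ‼ 0) (μ ‼ 0) (row-nonempty 0 h))
  span-profile (suc r) h = trans (cong₂ _+_ e1 (span-profile r (<-trans (n<1+n r) h)))
                       (span-step (μ ‼ suc r) (μ ‼ r) (la ‼ suc r) (la ‼ 0) (μ-decreasing r) (rows-adjacent r) (la-≤-first (suc r)))
    where
      e1 : suc (la ‼ suc r ∸ suc (μ ‼ suc r)) ∸ overhang (suc r) ≡ (la ‼ suc r ∸ μ ‼ suc r) ∸ (la ‼ suc r ∸ μ ‼ r)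
      e1 = cong (_∸ overhang (suc r)) (sym (∸-suc (la ‼ suc r) (μ ‼ suc r) (row-nonempty (suc r) h)))

  nuPrefix : ℕ → List ℕ
  nuPrefix r = map (λ x → la ‼ 0 ∸ x) (reverse (take r (drop 1 la)))

  length-drop1 : length (drop 1 la) ≡ k ∸ 1
  length-drop1 = length-drop 1 la

  bounds-profile : ∀ r → r < k → bounds (profileUpTo (suc r)) ≡ nuPrefix r
  bounds-profile zero h = refl
  bounds-profile (suc r) h = trans (cong₂ _∷_ hd (bounds-profile r (<-trans (n<1+n r) h))) (sym tl-eq)
    where
      hd : span (profileUpTo (suc r)) ∸ overhang (suc r) ≡ la ‼ 0 ∸ la ‼ suc r
      hd = trans (cong (_∸ overhang (suc r)) (span-profile r (<-trans (n<1+n r) h))) (span-minus-overhang (μ ‼ r) (la ‼ suc r) (la ‼ 0) (rows-adjacent r) (la-≤-first (suc r)))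
      r<d : r < length (drop 1 la)
      r<d = subst (r <_) (sym length-drop1) (∸-monoˡ-< {suc r} {1} {k} h (s≤s z≤n))
      tl-eq : nuPrefix (suc r) ≡ (la ‼ 0 ∸ la ‼ suc r) ∷ nuPrefix r
      tl-eq = trans (cong (λ z → map (λ x → la ‼ 0 ∸ x) (reverse z)) (take-suc (drop 1 la) r r<d))
              (trans (cong (map (λ x → la ‼ 0 ∸ x)) (reverse-++ (take r (drop 1 la)) [ drop 1 la ‼ r ]))
                 (cong (λ z → (la ‼ 0 ∸ z) ∷ nuPrefix r) (drop1-‼ la r)))

  nu≡bounds : 1 ≤ k → nu la ≡ bounds prof
  nu≡bounds h = trans (cong (λ z → map (λ x → la ‼ 0 ∸ x) (reverse z)) (sym (take-all (k ∸ 1) (drop 1 la) (≤-reflexive length-drop1))))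
              (trans (sym (bounds-profile (k ∸ 1) (∸-monoʳ-< {k} {1} {0} (s≤s z≤n) h))) (cong (λ z → bounds (profileUpTo z)) (trans (+-comm 1 (k ∸ 1)) (m∸n+n≡m h))))

  ribbonProfile : No2x2 la μ → ∀ n → n ≤ k → RibbonProfile (profileUpTo n)
  ribbonProfile no2 zero _ = []
  ribbonProfile no2 (suc zero) h = z≤n ∷ []
  ribbonProfile no2 (suc (suc n)) h = c≤1 ∷ ribbonProfile no2 (suc n) (<⇒≤ h)
    where
      c≤1 : la ‼ suc n ∸ μ ‼ n ≤ 1
      c≤1 = (≤-trans (∸-monoˡ-≤ (μ ‼ n) (ribbon-overlap≤1 no2 n h)) (≤-reflexive (trans (+-∸-assoc 1 {μ ‼ n} ≤-refl) (cong suc (n∸n≡0 (μ ‼ n))))))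

  -- In a standard tableau, a 2×2 square with entries a (top left), b (bottom left) and
  -- d (bottom right) has a < b < d, and the reading word lists b, d before a: a 231 pattern.
  avoidingSYT⇒no2x2 : (T : List (List ℕ)) → AvoidingSYT la μ T → No2x2 la μ
  avoidingSYT⇒no2x2 T ((lens , perm , rowc , colc) , av) r c (s1 , s2 , s3 , s4) =
    av (P + jb) (P + suc jb) (P + (length Bb + ja)) b d a (+-monoʳ-< P ≤-refl) (+-monoʳ-< P (≤-trans jb<Bb (m≤m+n _ ja)))
       eb ed ea (colc r c a b atA atB , rowc (suc r) c b d atB atD)
    where
      lT = rows-count T lens
      sr<k : suc r < k
      sr<k with suc r <? k
      ... | yes q = q
      ... | no q = ⊥-elim (<⇒≱ (≤-<-trans z≤n (proj₂ s3)) (≤-reflexive (‼-beyond-length la (suc r) (≮⇒≥ q))))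
      ex1 = lookupM-defined T r (subst (r <_) (sym lT) (<-trans (n<1+n r) sr<k))
      ex2 = lookupM-defined T (suc r) (subst (suc r <_) (sym lT) sr<k)
      Ba = proj₁ ex1
      Bb = proj₁ ex2
      ja = c ∸ μ ‼ r
      jb = c ∸ μ ‼ suc r
      ja<Ba : ja < length Ba
      ja<Ba = subst (ja <_) (sym (row-length T lens r Ba (proj₂ ex1))) (∸-monoˡ-< (proj₂ s1) (proj₁ s1))
      jb<Bb : suc jb < length Bb
      jb<Bb = subst (suc jb <_) (sym (row-length T lens (suc r) Bb (proj₂ ex2)))
                (subst (_< la ‼ suc r ∸ μ ‼ suc r) (+-∸-assoc 1 (proj₁ s3)) (∸-monoˡ-< (proj₂ s4) (≤-trans (proj₁ s3) (n≤1+n c))))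
      a = Ba ‼ ja
      b = Bb ‼ jb
      d = Bb ‼ suc jb
      atA : At μ T r c a
      atA = Ba , proj₂ ex1 , proj₁ s1 , lookupM-‼ Ba ja ja<Ba
      atB : At μ T (suc r) c b
      atB = Bb , proj₂ ex2 , proj₁ s3 , lookupM-‼ Bb jb (<-trans (n<1+n jb) jb<Bb)
      atD : At μ T (suc r) (suc c) d
      atD = Bb , proj₂ ex2 , ≤-trans (proj₁ s3) (n≤1+n c) , subst (λ z → lookupM Bb z ≡ just d) (sym (+-∸-assoc 1 (proj₁ s3))) (lookupM-‼ Bb (suc jb) jb<Bb)
      rc = reading-consecutive T r Ba Bb (proj₂ ex1) (proj₂ ex2)
      P = length (proj₁ rc)
      at : ∀ x → lookupM (readingWord T) (P + x) ≡ lookupM (Bb ++ Ba ++ proj₁ (proj₂ rc)) x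
      at x = trans (cong (λ z → lookupM z (P + x)) (proj₂ (proj₂ rc))) (lookupM-++ʳ (proj₁ rc) _ x)
      eb : lookupM (readingWord T) (P + jb) ≡ just b
      eb = trans (at jb) (trans (lookupM-++ˡ Bb _ jb (<-trans (n<1+n jb) jb<Bb)) (lookupM-‼ Bb jb (<-trans (n<1+n jb) jb<Bb)))
      ed : lookupM (readingWord T) (P + suc jb) ≡ just d
      ed = trans (at (suc jb)) (trans (lookupM-++ˡ Bb _ (suc jb) jb<Bb) (lookupM-‼ Bb (suc jb) jb<Bb))
      ea : lookupM (readingWord T) (P + (length Bb + ja)) ≡ just a
      ea = trans (at (length Bb + ja)) (trans (lookupM-++ʳ Bb _ ja) (trans (lookupM-++ˡ Ba _ ja ja<Ba) (lookupM-‼ Ba ja ja<Ba)))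

  tableauOf : List ℕ → List (List ℕ)
  tableauOf cs = reverse (encode prof cs)

  avoidingSYT-enumerated : No2x2 la μ → 1 ≤ k → ∀ T → (T ∈ map tableauOf (admissibles prof)) ⇔ AvoidingSYT la μ T
  avoidingSYT-enumerated no2 k1 T = mk⇔ to from
    where
      wf = ribbonProfile no2 k ≤-refl
      to : T ∈ map tableauOf (admissibles prof) → AvoidingSYT la μ T
      to m with ∈-map⁻ tableauOf m
      ... | cs , mc , refl = tableauRows⇒syt no2 T (rowShape⇒tableauRows T (proj₁ G)) (perm-unreverse T (proj₁ (proj₂ G))) , proj₂ (proj₂ G)
        where
          G : GoodFilling prof (reverse T)
          G = subst (GoodFilling prof) (sym (reverse-involutive (encode prof cs))) (EncodingFacts.good (encoding-facts prof wf cs (admissibles-sound prof cs mc)))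
      from : AvoidingSYT la μ T → T ∈ map tableauOf (admissibles prof)
      from (syt , av) = subst (_∈ map tableauOf (admissibles prof)) (sym Teq) (∈-map⁺ tableauOf (admissibles-complete prof cs (proj₁ (proj₂ S))))
        where
          S = encoding-complete prof (subst (1 ≤_) (sym (length-profileUpTo k)) k1) wf (reverse T)
                (tableauRows⇒rowShape T (syt⇒tableauRows T syt) , perm-reverse T (proj₁ (proj₂ syt)) , av)
          cs = proj₁ S
          Teq : T ≡ tableauOf cs
          Teq = trans (sym (reverse-involutive T)) (cong reverse (proj₂ (proj₂ S)))

  avoidingSYT-count : No2x2 la μ → 1 ≤ k → AvoidingSYT la μ HasSize length (admissibles prof)
  avoidingSYT-count no2 k1 = enumeration-size tableauOf (admissibles prof) (admissibles-unique prof)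
    (λ x y mx my e → encoding-injective prof (ribbonProfile no2 k ≤-refl) x y (admissibles-sound prof x mx) (admissibles-sound prof y my) (reverse-injective e))
    (avoidingSYT-enumerated no2 k1)

  partitions-count : 1 ≤ k → PartitionIn (nu la) HasSize length (admissibles prof)
  partitions-count k1 = enumeration-size toPartition (admissibles prof) (admissibles-unique prof)
    (λ x y mx my → toPartition-injective x y (trans (proj₁ (admissible⇒bounded prof x (admissibles-sound prof x mx))) (sym (proj₁ (admissible⇒bounded prof y (admissibles-sound prof y my))))))
    (partitions-enumerated prof (subst (1 ≤_) (sym (length-profileUpTo k)) k1) (nu la) (λ r → cong (_‼ r) (nu≡bounds k1)))

  nonribbon-count : ¬ No2x2 la μ → AvoidingSYT la μ HasSize 0
  nonribbon-count sq = [] , [] , refl , λ T → mk⇔ (λ ()) (λ avs → ⊥-elim (sq (avoidingSYT⇒no2x2 T avs)))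

corollary7p7 : (la μ : List ℕ) → IsPartition la → 1 ≤ length la →
    IsPartition μ → μ ⊆ᵖ la → BoundaryCond la μ →
    (No2x2 la μ →
    Σ ℕ (λ n → AvoidingSYT la μ HasSize n × PartitionIn (nu la) HasSize n))
    × (¬ No2x2 la μ → AvoidingSYT la μ HasSize 0)
corollary7p7 la μ pla k1 pμ sub bc =
  (λ no2 → length (admissibles prof) , avoidingSYT-count no2 k1 , partitions-count k1) , nonribbon-count
  where open SkewShape la μ pla pμ sub bc
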